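{- Let $R$ be a $\mathbb{Q}$-algebra and let $f:\mathcal{H}_{\ast}\to R$ be a $\mathbb{Q}$-linear map satisfying the series shuffle (stuffle) relation $f(u\ast v)=f(u)f(v)$ for all $u,v\in\mathcal{H}_{\ast}$. Define $g:\mathcal{H}_{\ast}\to R[[T]]$ by $$ g(y_{s_d}\cdots y_{s_1})=\sum_{k=0}^{d} f\big(\rho_T(y_{s_d}\cdots y_{s_{k+1}})\big)\, f(y_{s_k}\cdots y_{s_1}), $$ extended linearly (i.e. $g$ is the convolution product, dual to deconcatenation, of $f\circ\rho_T$ and $f$). Then $g$ also satisfies the series shuffle relation: $g(u\ast v)=g(u)g(v)$ for all $u,v\in\mathcal{H}_{\ast}$ (where $g$ is extended $R[[T]]$-linearly).
   Context: $\mathcal{H}_{\ast}=\mathbb{Q}\langle (y_s)_{s\geq 1}\rangle$ is the free non-commutative algebra on letters $y_s$, $s\in\mathbb{N}^{\ast}$, with $y_0:=1$ (empty word), equipped with the stuffle product $\ast$ defined recursively by $1\ast w=w\ast 1=w$ and $y_s w_1\ast y_{s'}w_2=y_s(w_1\ast y_{s'}w_2)+y_{s'}(y_sw_1\ast w_2)+y_{s+s'}(w_1\ast w_2)$ for words $w_1,w_2$ and $s,s'\geq1$; this is extended $T$-bilinearly to $\mathcal{H}_{\ast}[[T]]$. Let $\imath_{\ast,T}:\mathcal{H}_{\ast}\to\mathcal{H}_{\ast}[[T]]$ be the unique morphism of concatenation algebras with $\imath_{\ast,T}(y_s)=\sum_{l\geq0}(-T)^l\binom{l+s-1}{l}y_{s+l}$,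 and $\mathrm{inv}:\mathcal{H}_{\ast}\to\mathcal{H}_{\ast}$ the unique anti-morphism of concatenation algebras with $\mathrm{inv}(y_n)=(-1)^n y_n$ (extended $T$-linearly). Put $\rho_T=\mathrm{inv}\circ\imath_{\ast,T}$; explicitly $\rho_T(1)=1$ and $\rho_T(y_{s_d}\cdots y_{s_1})=(-1)^{s_1+\cdots+s_d}\sum_{l_1,\ldots,l_d\geq0}\prod_{i=1}^d\binom{l_i+s_i-1}{l_i}T^{l_i}\; y_{s_1+l_1}y_{s_2+l_2}\cdots y_{s_d+l_d}$. Maps $\mathcal{H}_{\ast}\to R$ are extended coefficientwise in $T$. -}

module Defs where

open import Level using (Level; _⊔_)
open import Data.Nat as ℕ using (ℕ; zero; suc; _∸_)
open import Data.Nat.Combinatorics using (_C_)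
open import Data.Integer using (+_)
open import Data.Rational as ℚ using (ℚ; 1ℚ; _/_)
open import Data.List using (List; []; _∷_; _++_; map; concatMap; foldr; reverse; upTo)
open import Data.Product using (_×_; _,_; proj₁; proj₂)
open import Algebra.Bundles using (Ring)
open import Algebra.Morphism.Structures using (module RingMorphisms)

-- Q-algebras: a (not necessarily commutative) ring R together with a
-- unital ring homomorphism ι : ℚ → R whose image is central.

record QAlgebra (c ℓ : Level) : Set (Level.suc (c ⊔ ℓ)) where
  field
    ring : Ring c ℓ
  open Ring ring public
  field
    ι       : ℚ → Carrier
    ι-hom   : RingMorphisms.IsRingHomomorphism ℚ.+-*-rawRing rawRing ι
    ι-central : ∀ q x → ι q * x ≈ x * ι q

-- ENCODING: the letter y_s (s ≥ 1) is represented by the natural number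
-- k = s - 1, i.e. the number k : ℕ stands for the letter y_(s k) with
--   s k = suc k.
-- A word y_{s_d} ⋯ y_{s_1} is the list [s_d - 1 , … , s_1 - 1]
-- (leftmost letter first); the empty word is 1.

Letter : Set
Letter = ℕ

s : Letter → ℕ
s k = suc k

Word : Set
Word = List Letter

_⊞_ : Letter → Letter → Letter
a ⊞ b = suc (a ℕ.+ b)            -- s (a ⊞ b) = s a + s b

weight : Word → ℕ
weight = foldr (λ a n → s a ℕ.+ n) 0

-- Elements of H_* are finite ℚ-linear combinations of words, represented
-- by (not necessarily reduced) lists of terms (coefficient , word).
Poly : Set
Poly = List (ℚ × Word)

word : Word → Poly
word w = (1ℚ , w) ∷ []

scale : ℚ → Poly → Poly
scale c = map (λ t → (c ℚ.* proj₁ t , proj₂ t))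

_◃_ : Letter → Poly → Poly
a ◃ p = map (λ t → (proj₁ t , a ∷ proj₂ t)) p

_·_ : Poly → Poly → Poly
p · q = concatMap (λ t → concatMap (λ u → (proj₁ t ℚ.* proj₁ u , proj₂ t ++ proj₂ u) ∷ []) q) p

stuffleW : Word → Word → Poly
stuffleW []      w       = word w
stuffleW (a ∷ u) []      = word (a ∷ u)
stuffleW (a ∷ u) (b ∷ v) =
  (a ◃ stuffleW u (b ∷ v)) ++ ((b ◃ stuffleW (a ∷ u) v) ++ ((a ⊞ b) ◃ stuffleW u v))

_∗_ : Poly → Poly → Poly
p ∗ q = concatMap (λ t → concatMap (λ u → scale (proj₁ t ℚ.* proj₁ u) (stuffleW (proj₂ t) (proj₂ u))) q) p

-- Formal power series in T: a series is its sequence of coefficients.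

antidiag : ℕ → List (ℕ × ℕ)
antidiag n = map (λ i → (i , n ∸ i)) (upTo (suc n))

PolySeries : Set
PolySeries = ℕ → Poly

_⋆_ : PolySeries → PolySeries → PolySeries
(A ⋆ B) n = concatMap (λ ij → A (proj₁ ij) · B (proj₂ ij)) (antidiag n)

sgn : ℕ → ℚ
sgn zero    = 1ℚ
sgn (suc n) = ℚ.- sgn n

nℚ : ℕ → ℚ
nℚ n = (+ n) / 1

-- ı_{∗,T}(y_s) = Σ_l (-T)^l binom(l+s-1, l) y_{s+l}
ıy : Letter → PolySeries
ıy a l = (sgn l ℚ.* nℚ ((l ℕ.+ (s a ∸ 1)) C l) , (l ℕ.+ a) ∷ []) ∷ []
  -- the letter l + a is y_{s a + l}

ıT : Word → PolySeries
ıT []      zero    = word []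
ıT []      (suc n) = []
ıT (a ∷ w)         = ıy a ⋆ ıT w

inv : Poly → Poly
inv = map (λ t → (sgn (weight (proj₂ t)) ℚ.* proj₁ t , reverse (proj₂ t)))

ρT : Word → PolySeries
ρT w n = inv (ıT w n)

module _ {c ℓ : Level} (R : QAlgebra c ℓ) where
  open QAlgebra R

  Σ_ : List Carrier → Carrier
  Σ_ = foldr _+_ 0#

  lin : (Word → Carrier) → Poly → Carrier
  lin f p = Σ map (λ t → ι (proj₁ t) * f (proj₂ t)) p

  Series : Set c
  Series = ℕ → Carrier

  _⊗_ : Series → Series → Series
  (A ⊗ B) n = Σ map (λ ij → A (proj₁ ij) * B (proj₂ ij)) (antidiag n)

  splits : Word → List (Word × Word)
  splits []      = ([] , []) ∷ []
  splits (a ∷ w) = ([] , a ∷ w) ∷ map (λ pq → (a ∷ proj₁ pq , proj₂ pq)) (splits w)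

  gW : (Word → Carrier) → Word → Series
  gW f w n = Σ map (λ pq → lin f (ρT (proj₁ pq) n) * f (proj₂ pq)) (splits w)

  g : (Word → Carrier) → Poly → Series
  g f p n = Σ map (λ t → ι (proj₁ t) * gW f (proj₂ t) n) p

  IsStuffleCharacter : (Poly → Carrier) → Set ℓ
  IsStuffleCharacter F = ∀ u v → F (u ∗ v) ≈ F u * F v

  IsStuffleCharacterT : (Poly → Series) → Set ℓ
  IsStuffleCharacterT G = ∀ u v n → G (u ∗ v) n ≈ (G u ⊗ G v) n

module Submission where

-- The argument is the paper's:
--   (1) ı_{∗,T} is a stuffle morphism H_* → H_*[[T]]: by induction on words,
--       using that the coefficients of ı(y_s) convolve to those of ı(y_{s+s'})
--       (a Chu–Vandermonde identity for binomial coefficients);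
--   (2) inv is a stuffle morphism: the stuffle is homogeneous for the weight
--       and invariant under reversal of words;
--   (3) hence f ∘ ρ_T = (f ∘ inv) ∘ ı is a character, coefficientwise in T;
--   (4) deconcatenation is a stuffle morphism, so the convolution of two
--       characters is a character — here we use that the values of f commute,
--       because the stuffle is commutative (R itself need not be).
-- Elements of H_* are tested against arbitrary maps φ : Word → R through the
-- linear extension ⟦ φ ⟧, so every identity in H_* is an identity in R.

open import Defs
open import Level using (Level)
open import Data.Nat as ℕ using (ℕ; zero; suc; _∸_)
open import Data.Nat.Combinatorics using (_C_; nCn≡1; nCk+nC[k+1]≡[n+1]C[k+1])
import Data.Nat.Properties as ℕP
open import Data.Nat.Tactic.RingSolver using (solve-∀)
import Data.Nat.Coprimality as Coprimality
import Data.Integer as ℤ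
import Data.Integer.Properties as ℤP
open import Data.Rational as ℚ using (ℚ; 1ℚ; mkℚ)
import Data.Rational.Properties as ℚP
open import Data.Product using (_,_; proj₁; proj₂)
open import Data.List using (List; []; _∷_; _++_; _∷ʳ_; map; concatMap; applyUpTo; reverse)
import Data.List.Properties as ListP
open import Algebra.Morphism.Structures using (module RingMorphisms)
open import Algebra.Bundles using (Semiring; CommutativeRing)
import Algebra.Properties.CommutativeSemigroup as CommSemigroupProperties
open import Function using (_∘_)
open import Relation.Binary.PropositionalEquality as ≡ using (_≡_)

module Antidiagonal {c ℓ} (S : Semiring c ℓ) where
  open Semiring S
  open import Relation.Binary.Reasoning.Setoid setoid
  open CommSemigroupProperties +-commutativeSemigroup using (interchange)

  Σad : ℕ → (ℕ → ℕ → Carrier) → Carrier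
  Σad zero    h = h 0 0
  Σad (suc n) h = h 0 (suc n) + Σad n (λ i j → h (suc i) j)

  Σad-cong : ∀ n {h k : ℕ → ℕ → Carrier} → (∀ i j → h i j ≈ k i j) → Σad n h ≈ Σad n k
  Σad-cong zero    e = e 0 0
  Σad-cong (suc n) e = +-cong (e 0 (suc n)) (Σad-cong n (λ i j → e (suc i) j))

  Σad-+ : ∀ n h k → Σad n (λ i j → h i j + k i j) ≈ Σad n h + Σad n k
  Σad-+ zero    h k = refl
  Σad-+ (suc n) h k = trans (+-congˡ (Σad-+ n _ _)) (interchange _ _ _ _)

  Σad-+₃ : ∀ n h k l → Σad n (λ i j → h i j + (k i j + l i j)) ≈ Σad n h + (Σad n k + Σad n l)
  Σad-+₃ n h k l = trans (Σad-+ n _ _) (+-congˡ (Σad-+ n k l))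

  Σad-*ˡ : ∀ n a h → Σad n (λ i j → a * h i j) ≈ a * Σad n h
  Σad-*ˡ zero    a h = refl
  Σad-*ˡ (suc n) a h = trans (+-congˡ (Σad-*ˡ n a _)) (sym (distribˡ _ _ _))

  Σad-*ʳ : ∀ n a h → Σad n (λ i j → h i j * a) ≈ Σad n h * a
  Σad-*ʳ zero    a h = refl
  Σad-*ʳ (suc n) a h = trans (+-congˡ (Σad-*ʳ n a _)) (sym (distribʳ _ _ _))

  Σad-shift : ∀ n (F : ℕ → ℕ → ℕ → Carrier) →
    Σad n (λ i j → F (i ℕ.+ j) i j) ≈ Σad n (λ i j → F n i j)
  Σad-shift zero    F = refl
  Σad-shift (suc n) F = +-congˡ (Σad-shift n (λ m i j → F (suc m) (suc i) j))

  Σad-zero : ∀ n h → (∀ i j → h i j ≈ 0#) → Σad n h ≈ 0#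
  Σad-zero zero    h e = e 0 0
  Σad-zero (suc n) h e = trans (+-cong (e _ _) (Σad-zero n _ (λ i j → e _ _))) (+-identityˡ _)

  Σad-left : ∀ n h → (∀ i j → h (suc i) j ≈ 0#) → Σad n h ≈ h 0 n
  Σad-left zero    h e = refl
  Σad-left (suc n) h e = trans (+-congˡ (Σad-zero n _ e)) (+-identityʳ _)

  Σad-snoc : ∀ n h → Σad (suc n) h ≈ Σad n (λ i j → h i (suc j)) + h (suc n) 0
  Σad-snoc zero    h = refl
  Σad-snoc (suc n) h = trans (+-congˡ (Σad-snoc n (λ i j → h (suc i) j))) (sym (+-assoc _ _ _))

  Σad-swap : ∀ n h → Σad n h ≈ Σad n (λ i j → h j i)
  Σad-swap zero    h = refl
  Σad-swap (suc n) h = begin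
    h 0 (suc n) + Σad n (λ i j → h (suc i) j)   ≈⟨ +-congˡ (Σad-swap n _) ⟩
    h 0 (suc n) + Σad n (λ i j → h (suc j) i)   ≈⟨ +-comm _ _ ⟩
    Σad n (λ i j → h (suc j) i) + h 0 (suc n)   ≈⟨ Σad-snoc n (λ i j → h j i) ⟨
    Σad (suc n) (λ i j → h j i)                 ∎

  Σad-right : ∀ n h → (∀ i j → h i (suc j) ≈ 0#) → Σad n h ≈ h n 0
  Σad-right n h e = trans (Σad-swap n h) (Σad-left n _ (λ i j → e j i))

  Σad-assoc : ∀ n (h : ℕ → ℕ → ℕ → Carrier) →
    Σad n (λ i j → Σad i (λ k m → h k m j)) ≈ Σad n (λ k r → Σad r (λ m j → h k m j))
  Σad-assoc zero    h = refl
  Σad-assoc (suc n) h = begin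
    h 0 0 (suc n) + Σad n (λ i j → h 0 (suc i) j + Σad i (λ k m → h (suc k) m j))
      ≈⟨ +-congˡ (Σad-+ n _ _) ⟩
    h 0 0 (suc n) + (Σad n (λ i j → h 0 (suc i) j) + Σad n (λ i j → Σad i (λ k m → h (suc k) m j)))
      ≈⟨ +-assoc _ _ _ ⟨
    Σad (suc n) (λ m j → h 0 m j) + Σad n (λ i j → Σad i (λ k m → h (suc k) m j))
      ≈⟨ +-congˡ (Σad-assoc n (λ k m j → h (suc k) m j)) ⟩
    Σad (suc n) (λ m j → h 0 m j) + Σad n (λ k r → Σad r (λ m j → h (suc k) m j)) ∎

  Σad-comm : ∀ n m (H : ℕ → ℕ → ℕ → ℕ → Carrier) →
    Σad n (λ i j → Σad m (λ k l → H i j k l)) ≈ Σad m (λ k l → Σad n (λ i j → H i j k l))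
  Σad-comm zero    m H = refl
  Σad-comm (suc n) m H = trans (+-congˡ (Σad-comm n m _)) (sym (Σad-+ m _ _))

  Σad-middle : ∀ n (H : ℕ → ℕ → ℕ → ℕ → Carrier) →
    Σad n (λ i j → Σad i (λ k m → Σad j (λ l m' → H k m l m'))) ≈
    Σad n (λ p r → Σad p (λ k l → Σad r (λ m m' → H k m l m')))
  Σad-middle n H = begin
    Σad n (λ i j → Σad i (λ k m → Σad j (λ l m' → H k m l m')))
      ≈⟨ Σad-assoc n (λ k m j → Σad j (λ l m' → H k m l m')) ⟩
    Σad n (λ k r → Σad r (λ m j → Σad j (λ l m' → H k m l m')))
      ≈⟨ Σad-cong n (λ k r → inner (H k) r) ⟩
    Σad n (λ k r → Σad r (λ l j → Σad j (λ m m' → H k m l m')))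
      ≈⟨ Σad-assoc n (λ k l j → Σad j (λ m m' → H k m l m')) ⟨
    Σad n (λ p r → Σad p (λ k l → Σad r (λ m m' → H k m l m'))) ∎
    where
    inner : ∀ (G : ℕ → ℕ → ℕ → Carrier) r →
      Σad r (λ m j → Σad j (λ l m' → G m l m')) ≈ Σad r (λ l j → Σad j (λ m m' → G m l m'))
    inner G r = begin
      Σad r (λ m j → Σad j (λ l m' → G m l m'))  ≈⟨ Σad-assoc r G ⟨
      Σad r (λ i m' → Σad i (λ m l → G m l m'))  ≈⟨ Σad-cong r (λ i m' → Σad-swap i _) ⟩
      Σad r (λ i m' → Σad i (λ l m → G m l m'))  ≈⟨ Σad-assoc r (λ l m m' → G m l m') ⟩
      Σad r (λ l j → Σad j (λ m m' → G m l m'))  ∎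

module AntidiagonalHomomorphism {c₁ ℓ₁ c₂ ℓ₂} (S : Semiring c₁ ℓ₁) (T : Semiring c₂ ℓ₂) where
  private
    module S = Semiring S
    module T = Semiring T
  open Antidiagonal S renaming (Σad to Σadˢ)
  open Antidiagonal T renaming (Σad to Σadᵗ)

  Σad-homo : (h : S.Carrier → T.Carrier) → (∀ x y → h (x S.+ y) T.≈ h x T.+ h y) →
    ∀ n g → h (Σadˢ n g) T.≈ Σadᵗ n (λ i j → h (g i j))
  Σad-homo h +-homo zero    g = T.refl
  Σad-homo h +-homo (suc n) g =
    T.trans (+-homo _ _) (T.+-congˡ (Σad-homo h +-homo n (λ i j → g (suc i) j)))

multichoose : ℕ → ℕ → ℕ
multichoose x       zero    = 1
multichoose zero    (suc k) = 1
multichoose (suc x) (suc k) = multichoose x (suc k) ℕ.+ multichoose (suc x) k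

multichoose≡C : ∀ x k → multichoose x k ≡ (k ℕ.+ x) C k
multichoose≡C x zero = ≡.refl
multichoose≡C zero (suc k) = ≡.sym (≡.trans (≡.cong (_C suc k) (ℕP.+-identityʳ (suc k))) (nCn≡1 (suc k)))
multichoose≡C (suc x) (suc k) = begin
  multichoose x (suc k) ℕ.+ multichoose (suc x) k    ≡⟨ ≡.cong₂ ℕ._+_ (multichoose≡C x (suc k)) (multichoose≡C (suc x) k) ⟩
  (suc k ℕ.+ x) C suc k ℕ.+ (k ℕ.+ suc x) C k         ≡⟨ ℕP.+-comm _ ((k ℕ.+ suc x) C k) ⟩
  (k ℕ.+ suc x) C k ℕ.+ (suc k ℕ.+ x) C suc k         ≡⟨ ≡.cong (λ m → (k ℕ.+ suc x) C k ℕ.+ m C suc k) (≡.sym (ℕP.+-suc k x)) ⟩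
  (k ℕ.+ suc x) C k ℕ.+ (k ℕ.+ suc x) C suc k         ≡⟨ nCk+nC[k+1]≡[n+1]C[k+1] (k ℕ.+ suc x) k ⟩
  (suc k ℕ.+ suc x) C suc k                           ∎
  where open ≡.≡-Reasoning

module ℕΣ = Antidiagonal ℕP.+-*-semiring

vandermonde : ∀ x y p →
  ℕΣ.Σad p (λ k l → multichoose x k ℕ.* multichoose y l) ≡ multichoose (suc (x ℕ.+ y)) p
vandermonde zero y p = ≡.trans (ℕΣ.Σad-cong p one-column) (hockey-stick y p)
  where
  one-column : ∀ k l → multichoose 0 k ℕ.* multichoose y l ≡ multichoose y l
  one-column zero    l = ℕP.+-identityʳ (multichoose y l)
  one-column (suc k) l = ℕP.+-identityʳ (multichoose y l)
  hockey-stick : ∀ y p → ℕΣ.Σad p (λ _ l → multichoose y l) ≡ multichoose (suc y) p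
  hockey-stick y zero    = ≡.refl
  hockey-stick y (suc p) = ≡.cong (multichoose y (suc p) ℕ.+_) (hockey-stick y p)
vandermonde (suc x) y zero = ≡.refl
-- (the leading summand is multichoose (suc x) 0 * _ = 1 * _)
vandermonde (suc x) y (suc p) = begin
  1 ℕ.* multichoose y (suc p) ℕ.+ ℕΣ.Σad p (λ k l → (multichoose x (suc k) ℕ.+ multichoose (suc x) k) ℕ.* multichoose y l)
    ≡⟨ ≡.cong (1 ℕ.* multichoose y (suc p) ℕ.+_)
         (≡.trans (ℕΣ.Σad-cong p (λ k l → ℕP.*-distribʳ-+ (multichoose y l) (multichoose x (suc k)) (multichoose (suc x) k))) (ℕΣ.Σad-+ p _ _)) ⟩
  1 ℕ.* multichoose y (suc p) ℕ.+ (ℕΣ.Σad p (λ k l → multichoose x (suc k) ℕ.* multichoose y l)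
                             ℕ.+ ℕΣ.Σad p (λ k l → multichoose (suc x) k ℕ.* multichoose y l))
    ≡⟨ ≡.sym (ℕP.+-assoc (1 ℕ.* multichoose y (suc p)) _ _) ⟩
  ℕΣ.Σad (suc p) (λ k l → multichoose x k ℕ.* multichoose y l)
    ℕ.+ ℕΣ.Σad p (λ k l → multichoose (suc x) k ℕ.* multichoose y l)
    ≡⟨ ≡.cong₂ ℕ._+_ (vandermonde x y (suc p)) (vandermonde (suc x) y p) ⟩
  multichoose (suc (suc (x ℕ.+ y))) (suc p) ∎
  where open ≡.≡-Reasoning

⊞-weight : ∀ a b m n → suc (suc (a ℕ.+ b)) ℕ.+ (m ℕ.+ n) ≡ (suc a ℕ.+ m) ℕ.+ (suc b ℕ.+ n)
⊞-weight = solve-∀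

⊞-shift : ∀ k x l y → suc ((k ℕ.+ x) ℕ.+ (l ℕ.+ y)) ≡ (k ℕ.+ l) ℕ.+ suc (x ℕ.+ y)
⊞-shift = solve-∀

sgn-+ : ∀ k l → sgn (k ℕ.+ l) ≡ sgn k ℚ.* sgn l
sgn-+ zero    l = ≡.sym (ℚP.*-identityˡ (sgn l))
sgn-+ (suc k) l = ≡.trans (≡.cong ℚ.-_ (sgn-+ k l)) (ℚP.neg-distribˡ-* (sgn k) (sgn l))

nℚ≡mkℚ : ∀ m → nℚ m ≡ mkℚ (ℤ.+ m) 0 (Coprimality.sym (Coprimality.1-coprimeTo m))
nℚ≡mkℚ m = ℚP.normalize-coprime (Coprimality.sym (Coprimality.1-coprimeTo m))

nℚ-+ : ∀ m n → nℚ (m ℕ.+ n) ≡ nℚ m ℚ.+ nℚ n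
nℚ-+ m n rewrite nℚ≡mkℚ m | nℚ≡mkℚ n =
  ≡.cong (ℚ._/ 1) (≡.cong₂ ℤ._+_ (≡.sym (ℤP.*-identityʳ (ℤ.+ m))) (≡.sym (ℤP.*-identityʳ (ℤ.+ n))))

nℚ-* : ∀ m n → nℚ (m ℕ.* n) ≡ nℚ m ℚ.* nℚ n
nℚ-* m n rewrite nℚ≡mkℚ m | nℚ≡mkℚ n = ≡.cong (ℚ._/ 1) (ℤP.pos-* m n)

-- ıcoeff a l is the coefficient of T^l y_{s+l} in ı_{∗,T}(y_s), s = s a:
-- (-1)^l (l+s-1 choose l).
ıcoeff : Letter → ℕ → ℚ
ıcoeff a l = sgn l ℚ.* nℚ ((l ℕ.+ a) C l)

module ℚΣ = Antidiagonal (CommutativeRing.semiring ℚP.+-*-commutativeRing)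

-- The letter-level identity behind "ı_{∗,T} respects the stuffle":
-- the coefficients of y_{s+s'} are the convolution of those of y_s, y_{s'}.
ıcoeff-convolution : ∀ x y p →
  ℚΣ.Σad p (λ k l → ıcoeff x k ℚ.* ıcoeff y l) ≡ ıcoeff (x ⊞ y) p
ıcoeff-convolution x y p = begin
  ℚΣ.Σad p (λ k l → ıcoeff x k ℚ.* ıcoeff y l)
    ≡⟨ ℚΣ.Σad-cong p product ⟩
  ℚΣ.Σad p (λ k l → sgn (k ℕ.+ l) ℚ.* nℚ (multichoose x k ℕ.* multichoose y l))
    ≡⟨ ℚΣ.Σad-shift p (λ m k l → sgn m ℚ.* nℚ (multichoose x k ℕ.* multichoose y l)) ⟩
  ℚΣ.Σad p (λ k l → sgn p ℚ.* nℚ (multichoose x k ℕ.* multichoose y l))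
    ≡⟨ ℚΣ.Σad-*ˡ p (sgn p) _ ⟩
  sgn p ℚ.* ℚΣ.Σad p (λ k l → nℚ (multichoose x k ℕ.* multichoose y l))
    ≡⟨ ≡.cong (sgn p ℚ.*_) (≡.sym (Σad-homo nℚ nℚ-+ p _)) ⟩
  sgn p ℚ.* nℚ (ℕΣ.Σad p (λ k l → multichoose x k ℕ.* multichoose y l))
    ≡⟨ ≡.cong (λ m → sgn p ℚ.* nℚ m) (≡.trans (vandermonde x y p) (multichoose≡C (suc (x ℕ.+ y)) p)) ⟩
  ıcoeff (x ⊞ y) p ∎
  where
  open ≡.≡-Reasoning
  open AntidiagonalHomomorphism ℕP.+-*-semiring (CommutativeRing.semiring ℚP.+-*-commutativeRing)
  open CommSemigroupProperties (CommutativeRing.*-commutativeSemigroup ℚP.+-*-commutativeRing) using (interchange)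
  product : ∀ k l → ıcoeff x k ℚ.* ıcoeff y l ≡ sgn (k ℕ.+ l) ℚ.* nℚ (multichoose x k ℕ.* multichoose y l)
  product k l = begin
    (sgn k ℚ.* nℚ ((k ℕ.+ x) C k)) ℚ.* (sgn l ℚ.* nℚ ((l ℕ.+ y) C l))
      ≡⟨ interchange (sgn k) _ (sgn l) _ ⟩
    (sgn k ℚ.* sgn l) ℚ.* (nℚ ((k ℕ.+ x) C k) ℚ.* nℚ ((l ℕ.+ y) C l))
      ≡⟨ ≡.cong₂ ℚ._*_ (≡.sym (sgn-+ k l))
           (≡.trans (≡.cong₂ (λ m n → nℚ m ℚ.* nℚ n) (≡.sym (multichoose≡C x k)) (≡.sym (multichoose≡C y l)))
                    (≡.sym (nℚ-* (multichoose x k) (multichoose y l)))) ⟩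
    sgn (k ℕ.+ l) ℚ.* nℚ (multichoose x k ℕ.* multichoose y l) ∎

module LinearExtension {c ℓ} (R : QAlgebra c ℓ) where
  open QAlgebra R
  open RingMorphisms.IsRingHomomorphism ι-hom using (1#-homo; +-homo; *-homo)
  open import Relation.Binary.Reasoning.Setoid setoid
  open Antidiagonal semiring public

  ∑ : List Carrier → Carrier
  ∑ = Σ_ R

  ⟦_⟧ : (Word → Carrier) → Poly → Carrier
  ⟦ φ ⟧ = lin R φ

  ι-swap : ∀ q a x → ι q * (a * x) ≈ a * (ι q * x)
  ι-swap q a x = trans (sym (*-assoc _ _ _)) (trans (*-congʳ (ι-central q a)) (*-assoc _ _ _))

  module _ {A : Set} where
    ∑map-cong : ∀ {h k : A → Carrier} ts → (∀ t → h t ≈ k t) → ∑ (map h ts) ≈ ∑ (map k ts)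
    ∑map-cong []       e = refl
    ∑map-cong (t ∷ ts) e = +-cong (e t) (∑map-cong ts e)

    ∑map-*ˡ : ∀ a (h : A → Carrier) ts → a * ∑ (map h ts) ≈ ∑ (map (λ t → a * h t) ts)
    ∑map-*ˡ a h []       = zeroʳ _
    ∑map-*ˡ a h (t ∷ ts) = trans (distribˡ _ _ _) (+-congˡ (∑map-*ˡ a h ts))

    ∑map-*ʳ : ∀ a (h : A → Carrier) ts → ∑ (map h ts) * a ≈ ∑ (map (λ t → h t * a) ts)
    ∑map-*ʳ a h []       = zeroˡ _
    ∑map-*ʳ a h (t ∷ ts) = trans (distribʳ _ _ _) (+-congˡ (∑map-*ʳ a h ts))

    ∑map-+ : ∀ (h k : A → Carrier) ts → ∑ (map (λ t → h t + k t) ts) ≈ ∑ (map h ts) + ∑ (map k ts)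
    ∑map-+ h k []       = sym (+-identityˡ _)
    ∑map-+ h k (t ∷ ts) = trans (+-congˡ (∑map-+ h k ts)) (interchange _ _ _ _)
      where open CommSemigroupProperties +-commutativeSemigroup using (interchange)

    Σad-∑ : ∀ n (H : ℕ → ℕ → A → Carrier) ts →
      Σad n (λ i j → ∑ (map (H i j) ts)) ≈ ∑ (map (λ t → Σad n (λ i j → H i j t)) ts)
    Σad-∑ n H []       = Σad-zero n _ (λ i j → refl)
    Σad-∑ n H (t ∷ ts) = trans (Σad-+ n _ _) (+-congˡ (Σad-∑ n H ts))

  ⟦⟧-++ : ∀ φ p q → ⟦ φ ⟧ (p ++ q) ≈ ⟦ φ ⟧ p + ⟦ φ ⟧ q
  ⟦⟧-++ φ []      q = sym (+-identityˡ _)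
  ⟦⟧-++ φ (t ∷ p) q = trans (+-congˡ (⟦⟧-++ φ p q)) (sym (+-assoc _ _ _))

  ⟦⟧-cong : ∀ {φ ψ} p → (∀ w → φ w ≈ ψ w) → ⟦ φ ⟧ p ≈ ⟦ ψ ⟧ p
  ⟦⟧-cong p e = ∑map-cong p (λ t → *-congˡ (e (proj₂ t)))

  ⟦⟧-word : ∀ φ w → ⟦ φ ⟧ (word w) ≈ φ w
  ⟦⟧-word φ w = trans (+-identityʳ _) (trans (*-congʳ 1#-homo) (*-identityˡ _))

  ⟦⟧-◃ : ∀ φ a p → ⟦ φ ⟧ (a ◃ p) ≡ ⟦ (λ w → φ (a ∷ w)) ⟧ p
  ⟦⟧-◃ φ a []      = ≡.refl
  ⟦⟧-◃ φ a (t ∷ p) = ≡.cong (_ +_) (⟦⟧-◃ φ a p)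

  ⟦⟧-scale : ∀ φ q p → ⟦ φ ⟧ (scale q p) ≈ ι q * ⟦ φ ⟧ p
  ⟦⟧-scale φ q []      = sym (zeroʳ _)
  ⟦⟧-scale φ q (t ∷ p) = begin
    ι (q ℚ.* proj₁ t) * φ (proj₂ t) + ⟦ φ ⟧ (scale q p)
      ≈⟨ +-cong (trans (*-congʳ (*-homo q (proj₁ t))) (*-assoc _ _ _)) (⟦⟧-scale φ q p) ⟩
    ι q * (ι (proj₁ t) * φ (proj₂ t)) + ι q * ⟦ φ ⟧ p
      ≈⟨ distribˡ _ _ _ ⟨
    ι q * (ι (proj₁ t) * φ (proj₂ t) + ⟦ φ ⟧ p) ∎

  ⟦⟧-concatMap : ∀ {A : Set} φ (h : A → Poly) ts → ⟦ φ ⟧ (concatMap h ts) ≈ ∑ (map (λ t → ⟦ φ ⟧ (h t)) ts)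
  ⟦⟧-concatMap φ h []       = refl
  ⟦⟧-concatMap φ h (t ∷ ts) = trans (⟦⟧-++ φ (h t) (concatMap h ts)) (+-congˡ (⟦⟧-concatMap φ h ts))

  ⟦⟧-*ˡ : ∀ a φ p → ⟦ (λ w → a * φ w) ⟧ p ≈ a * ⟦ φ ⟧ p
  ⟦⟧-*ˡ a φ p = trans (∑map-cong p (λ t → ι-swap (proj₁ t) a (φ (proj₂ t)))) (sym (∑map-*ˡ a _ p))

  ⟦⟧-*ʳ : ∀ a φ p → ⟦ (λ w → φ w * a) ⟧ p ≈ ⟦ φ ⟧ p * a
  ⟦⟧-*ʳ a φ p = trans (∑map-cong p (λ t → sym (*-assoc _ _ _))) (sym (∑map-*ʳ a _ p))

  ⟦⟧-+ : ∀ φ ψ p → ⟦ (λ w → φ w + ψ w) ⟧ p ≈ ⟦ φ ⟧ p + ⟦ ψ ⟧ p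
  ⟦⟧-+ φ ψ p = trans (∑map-cong p (λ t → distribˡ _ _ _)) (∑map-+ _ _ p)

  ⟦⟧-+₃ : ∀ φ ψ χ p → ⟦ (λ w → φ w + (ψ w + χ w)) ⟧ p ≈ ⟦ φ ⟧ p + (⟦ ψ ⟧ p + ⟦ χ ⟧ p)
  ⟦⟧-+₃ φ ψ χ p = trans (⟦⟧-+ φ _ p) (+-congˡ (⟦⟧-+ ψ χ p))

  distribˡ₃ : ∀ a x y z → a * (x + (y + z)) ≈ a * x + (a * y + a * z)
  distribˡ₃ a x y z = trans (distribˡ _ _ _) (+-congˡ (distribˡ _ _ _))

  ⟦⟧-zero : ∀ φ p → (∀ w → φ w ≈ 0#) → ⟦ φ ⟧ p ≈ 0#
  ⟦⟧-zero φ []      e = refl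
  ⟦⟧-zero φ (t ∷ p) e = trans (+-cong (trans (*-congˡ (e _)) (zeroʳ _)) (⟦⟧-zero φ p e)) (+-identityˡ _)

  ⟦⟧-product : ∀ φ ψ p q → ⟦ φ ⟧ p * ⟦ ψ ⟧ q ≈ ⟦ (λ a → ⟦ (λ b → φ a * ψ b) ⟧ q) ⟧ p
  ⟦⟧-product φ ψ p q = trans (sym (⟦⟧-*ʳ (⟦ ψ ⟧ q) φ p)) (⟦⟧-cong p (λ a → sym (⟦⟧-*ˡ (φ a) ψ q)))

  Σad-⟦⟧ : ∀ n (H : ℕ → ℕ → Word → Carrier) p →
    Σad n (λ i j → ⟦ H i j ⟧ p) ≈ ⟦ (λ w → Σad n (λ i j → H i j w)) ⟧ p
  Σad-⟦⟧ n H p = trans (Σad-∑ n _ p) (∑map-cong p (λ t → Σad-*ˡ n (ι (proj₁ t)) _))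

  ⟦⟧-∗ : ∀ φ p q → ⟦ φ ⟧ (p ∗ q) ≈ ⟦ (λ a → ⟦ (λ b → ⟦ φ ⟧ (stuffleW a b)) ⟧ q) ⟧ p
  ⟦⟧-∗ φ p q = trans (⟦⟧-concatMap φ _ p) (∑map-cong p λ t →
    trans (⟦⟧-concatMap φ _ q) (trans (∑map-cong q (λ u →
      trans (⟦⟧-scale φ _ (stuffleW (proj₂ t) (proj₂ u)))
        (trans (*-congʳ (*-homo (proj₁ t) (proj₁ u))) (*-assoc _ _ _))))
      (sym (∑map-*ˡ (ι (proj₁ t)) _ q))))

  ∑antidiag≈Σad : ∀ n (h : ℕ → ℕ → Carrier) → ∑ (map (λ ij → h (proj₁ ij) (proj₂ ij)) (antidiag n)) ≈ Σad n h
  ∑antidiag≈Σad n h = trans (reflexive (≡.cong ∑ (≡.trans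
      (≡.cong (map _) (ListP.map-applyUpTo (λ i → i) (λ i → (i , n ∸ i)) (suc n)))
      (ListP.map-applyUpTo (λ i → (i , n ∸ i)) (λ ij → h (proj₁ ij) (proj₂ ij)) (suc n)))))
    (sym (Σad-list n h))
    where
    Σad-list : ∀ n (h : ℕ → ℕ → Carrier) → Σad n h ≈ ∑ (applyUpTo (λ i → h i (n ∸ i)) (suc n))
    Σad-list zero    h = sym (+-identityʳ _)
    Σad-list (suc n) h = +-congˡ (Σad-list n (λ i j → h (suc i) j))

  ι-convolution : ∀ x y p → Σad p (λ k l → ι (ıcoeff x k) * ι (ıcoeff y l)) ≈ ι (ıcoeff (x ⊞ y) p)
  ι-convolution x y p = begin
    Σad p (λ k l → ι (ıcoeff x k) * ι (ıcoeff y l))   ≈⟨ Σad-cong p (λ k l → sym (*-homo _ _)) ⟩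
    Σad p (λ k l → ι (ıcoeff x k ℚ.* ıcoeff y l))     ≈⟨ Σad-homo ι +-homo p _ ⟨
    ι (ℚΣ.Σad p (λ k l → ıcoeff x k ℚ.* ıcoeff y l))  ≈⟨ reflexive (≡.cong ι (ıcoeff-convolution x y p)) ⟩
    ι (ıcoeff (x ⊞ y) p) ∎
    where open AntidiagonalHomomorphism (CommutativeRing.semiring ℚP.+-*-commutativeRing) semiring

-- The recursion defining
-- stuffleW peels letters off the left; reversal invariance requires the
-- same recursion on the right, and the sign in inv requires homogeneity.
module StuffleIdentities {c ℓ} (R : QAlgebra c ℓ) where
  open QAlgebra R
  open LinearExtension R
  open import Relation.Binary.Reasoning.Setoid setoid
  open import Algebra.Solver.CommutativeMonoid +-commutativeMonoid using (solve; _⊜_; _⊕_; id)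

  _⊳_ : Letter → (Word → Carrier) → Word → Carrier
  (a ⊳ φ) w = φ (a ∷ w)

  _⊲_ : (Word → Carrier) → Letter → Word → Carrier
  (φ ⊲ a) w = φ (w ∷ʳ a)

  stuffle-nilʳ : ∀ φ u → ⟦ φ ⟧ (stuffleW u []) ≈ ⟦ φ ⟧ (word u)
  stuffle-nilʳ φ []      = refl
  stuffle-nilʳ φ (a ∷ u) = refl

  stuffle-cons : ∀ φ a u b v → ⟦ φ ⟧ (stuffleW (a ∷ u) (b ∷ v)) ≈
    ⟦ a ⊳ φ ⟧ (stuffleW u (b ∷ v)) + (⟦ b ⊳ φ ⟧ (stuffleW (a ∷ u) v) + ⟦ (a ⊞ b) ⊳ φ ⟧ (stuffleW u v))
  stuffle-cons φ a u b v = trans (⟦⟧-++ φ (a ◃ stuffleW u (b ∷ v)) _)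
    (+-cong (reflexive (⟦⟧-◃ φ a (stuffleW u (b ∷ v)))) (trans (⟦⟧-++ φ (b ◃ stuffleW (a ∷ u) v) _)
      (+-cong (reflexive (⟦⟧-◃ φ b (stuffleW (a ∷ u) v))) (reflexive (⟦⟧-◃ φ (a ⊞ b) (stuffleW u v))))))

  stuffle-comm : ∀ φ u v → ⟦ φ ⟧ (stuffleW u v) ≈ ⟦ φ ⟧ (stuffleW v u)
  stuffle-comm φ []      []      = refl
  stuffle-comm φ []      (b ∷ v) = refl
  stuffle-comm φ (a ∷ u) []      = refl
  stuffle-comm φ (a ∷ u) (b ∷ v) = begin
    ⟦ φ ⟧ (stuffleW (a ∷ u) (b ∷ v))
      ≈⟨ stuffle-cons φ a u b v ⟩
    ⟦ a ⊳ φ ⟧ (stuffleW u (b ∷ v)) + (⟦ b ⊳ φ ⟧ (stuffleW (a ∷ u) v) + ⟦ (a ⊞ b) ⊳ φ ⟧ (stuffleW u v))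
      ≈⟨ +-cong (stuffle-comm _ u (b ∷ v)) (+-cong (stuffle-comm _ (a ∷ u) v)
           (trans (stuffle-comm _ u v) (reflexive (≡.cong (λ z → ⟦ z ⊳ φ ⟧ (stuffleW v u)) ⊞-comm)))) ⟩
    ⟦ a ⊳ φ ⟧ (stuffleW (b ∷ v) u) + (⟦ b ⊳ φ ⟧ (stuffleW v (a ∷ u)) + ⟦ (b ⊞ a) ⊳ φ ⟧ (stuffleW v u))
      ≈⟨ x∙yz≈y∙xz _ _ _ ⟩
    ⟦ b ⊳ φ ⟧ (stuffleW v (a ∷ u)) + (⟦ a ⊳ φ ⟧ (stuffleW (b ∷ v) u) + ⟦ (b ⊞ a) ⊳ φ ⟧ (stuffleW v u))
      ≈⟨ stuffle-cons φ b v a u ⟨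
    ⟦ φ ⟧ (stuffleW (b ∷ v) (a ∷ u)) ∎
    where
    open CommSemigroupProperties +-commutativeSemigroup using (x∙yz≈y∙xz)
    ⊞-comm : a ⊞ b ≡ b ⊞ a
    ⊞-comm = ≡.cong suc (ℕP.+-comm a b)

  stuffle-weight : ∀ (χ : ℕ → Word → Carrier) u v →
    ⟦ (λ w → χ (weight w) w) ⟧ (stuffleW u v) ≈ ⟦ χ (weight u ℕ.+ weight v) ⟧ (stuffleW u v)
  stuffle-weight χ []      v       = refl
  stuffle-weight χ (a ∷ u) []      = reflexive (≡.cong (λ m → ⟦ χ m ⟧ (word (a ∷ u))) (≡.sym (ℕP.+-identityʳ _)))
  stuffle-weight χ (a ∷ u) (b ∷ v) = begin
    ⟦ (λ w → χ (weight w) w) ⟧ (stuffleW (a ∷ u) (b ∷ v))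
      ≈⟨ stuffle-cons _ a u b v ⟩
    ⟦ (λ w → χ (s a ℕ.+ weight w) (a ∷ w)) ⟧ (stuffleW u (b ∷ v))
      + (⟦ (λ w → χ (s b ℕ.+ weight w) (b ∷ w)) ⟧ (stuffleW (a ∷ u) v)
      + ⟦ (λ w → χ (s (a ⊞ b) ℕ.+ weight w) ((a ⊞ b) ∷ w)) ⟧ (stuffleW u v))
      ≈⟨ +-cong (step a (λ m → s a ℕ.+ m) u (b ∷ v) (≡.sym (ℕP.+-assoc (s a) (weight u) _)))
         (+-cong (step b (λ m → s b ℕ.+ m) (a ∷ u) v (ℕ-x∙yz≈y∙xz (s b) (weight (a ∷ u)) _))
                 (step (a ⊞ b) (λ m → s (a ⊞ b) ℕ.+ m) u v (⊞-weight a b (weight u) (weight v)))) ⟩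
    ⟦ a ⊳ χ W ⟧ (stuffleW u (b ∷ v)) + (⟦ b ⊳ χ W ⟧ (stuffleW (a ∷ u) v) + ⟦ (a ⊞ b) ⊳ χ W ⟧ (stuffleW u v))
      ≈⟨ stuffle-cons _ a u b v ⟨
    ⟦ χ W ⟧ (stuffleW (a ∷ u) (b ∷ v)) ∎
    where
    W = weight (a ∷ u) ℕ.+ weight (b ∷ v)
    open CommSemigroupProperties ℕP.+-commutativeSemigroup renaming (x∙yz≈y∙xz to ℕ-x∙yz≈y∙xz)
    step : ∀ c (shift : ℕ → ℕ) u' v' → shift (weight u' ℕ.+ weight v') ≡ W →
      ⟦ (λ w → χ (shift (weight w)) (c ∷ w)) ⟧ (stuffleW u' v') ≈ ⟦ c ⊳ χ W ⟧ (stuffleW u' v')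
    step c shift u' v' e = trans (stuffle-weight (λ m w → χ (shift m) (c ∷ w)) u' v')
      (reflexive (≡.cong (λ m → ⟦ c ⊳ χ m ⟧ (stuffleW u' v')) e))

  stuffle-snoc : ∀ u v x y φ → ⟦ φ ⟧ (stuffleW (u ∷ʳ x) (v ∷ʳ y)) ≈
    ⟦ φ ⊲ x ⟧ (stuffleW u (v ∷ʳ y)) + (⟦ φ ⊲ y ⟧ (stuffleW (u ∷ʳ x) v) + ⟦ φ ⊲ (x ⊞ y) ⟧ (stuffleW u v))
  stuffle-snoc [] [] x y φ =
    solve 3 (λ A B C → A ⊕ (B ⊕ (C ⊕ id)) ⊜ (B ⊕ id) ⊕ ((A ⊕ id) ⊕ (C ⊕ id))) refl
      (ι 1ℚ * φ (x ∷ y ∷ [])) (ι 1ℚ * φ (y ∷ x ∷ [])) (ι 1ℚ * φ ((x ⊞ y) ∷ []))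
  stuffle-snoc [] (b ∷ v) x y φ = begin
    ⟦ φ ⟧ (stuffleW (x ∷ []) (b ∷ V))
      ≈⟨ stuffle-cons φ x [] b V ⟩
    P₁ + (⟦ b ⊳ φ ⟧ (stuffleW (x ∷ []) V) + P₃)
      ≈⟨ +-congˡ (+-congʳ (stuffle-snoc [] v x y (b ⊳ φ))) ⟩
    P₁ + ((Q₁ + (Q₂ + Q₃)) + P₃)
      ≈⟨ solve 5 (λ P₁ Q₁ Q₂ Q₃ P₃ → P₁ ⊕ ((Q₁ ⊕ (Q₂ ⊕ Q₃)) ⊕ P₃) ⊜ Q₁ ⊕ ((P₁ ⊕ (Q₂ ⊕ P₃)) ⊕ Q₃)) refl
           P₁ Q₁ Q₂ Q₃ P₃ ⟩
    Q₁ + ((P₁ + (Q₂ + P₃)) + Q₃)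
      ≈⟨ +-congˡ (+-congʳ (stuffle-cons (φ ⊲ y) x [] b v)) ⟨
    ⟦ φ ⊲ x ⟧ (stuffleW [] (b ∷ V)) + (⟦ φ ⊲ y ⟧ (stuffleW (x ∷ []) (b ∷ v)) + ⟦ φ ⊲ (x ⊞ y) ⟧ (stuffleW [] (b ∷ v))) ∎
    where
    V = v ∷ʳ y
    P₁ = ⟦ x ⊳ φ ⟧ (stuffleW [] (b ∷ V))
    P₃ = ⟦ (x ⊞ b) ⊳ φ ⟧ (stuffleW [] V)
    Q₁ = ⟦ (b ⊳ φ) ⊲ x ⟧ (stuffleW [] V)
    Q₂ = ⟦ (b ⊳ φ) ⊲ y ⟧ (stuffleW (x ∷ []) v)
    Q₃ = ⟦ (b ⊳ φ) ⊲ (x ⊞ y) ⟧ (stuffleW [] v)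
  stuffle-snoc (a ∷ u) [] x y φ = begin
    ⟦ φ ⟧ (stuffleW (a ∷ U) (y ∷ []))
      ≈⟨ stuffle-cons φ a U y [] ⟩
    ⟦ a ⊳ φ ⟧ (stuffleW U (y ∷ [])) + (P₂ + ⟦ (a ⊞ y) ⊳ φ ⟧ (stuffleW U []))
      ≈⟨ +-cong (stuffle-snoc u [] x y (a ⊳ φ)) (+-congˡ (stuffle-nilʳ ((a ⊞ y) ⊳ φ) U)) ⟩
    (Q₁ + (⟦ (a ⊳ φ) ⊲ y ⟧ (stuffleW U []) + ⟦ (a ⊳ φ) ⊲ (x ⊞ y) ⟧ (stuffleW u []))) + (P₂ + P₃)
      ≈⟨ +-congʳ (+-congˡ (+-cong (stuffle-nilʳ ((a ⊳ φ) ⊲ y) U) (stuffle-nilʳ ((a ⊳ φ) ⊲ (x ⊞ y)) u))) ⟩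
    (Q₁ + (Q₂ + Q₃)) + (P₂ + P₃)
      ≈⟨ solve 5 (λ Q₁ Q₂ Q₃ P₂ P₃ → (Q₁ ⊕ (Q₂ ⊕ Q₃)) ⊕ (P₂ ⊕ P₃) ⊜ (Q₁ ⊕ (P₂ ⊕ P₃)) ⊕ (Q₂ ⊕ Q₃)) refl
           Q₁ Q₂ Q₃ P₂ P₃ ⟩
    (Q₁ + (P₂ + P₃)) + (Q₂ + Q₃)
      ≈⟨ +-cong (+-congˡ (+-congˡ (stuffle-nilʳ ((a ⊞ y) ⊳ (φ ⊲ x)) u)))
                (+-cong (stuffle-nilʳ (φ ⊲ y) (a ∷ U)) (stuffle-nilʳ (φ ⊲ (x ⊞ y)) (a ∷ u))) ⟨
    (Q₁ + (P₂ + ⟦ (a ⊞ y) ⊳ (φ ⊲ x) ⟧ (stuffleW u []))) + (⟦ φ ⊲ y ⟧ (stuffleW (a ∷ U) []) + ⟦ φ ⊲ (x ⊞ y) ⟧ (stuffleW (a ∷ u) []))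
      ≈⟨ +-congʳ (stuffle-cons (φ ⊲ x) a u y []) ⟨
    ⟦ φ ⊲ x ⟧ (stuffleW (a ∷ u) (y ∷ [])) + (⟦ φ ⊲ y ⟧ (stuffleW (a ∷ U) []) + ⟦ φ ⊲ (x ⊞ y) ⟧ (stuffleW (a ∷ u) [])) ∎
    where
    U = u ∷ʳ x
    P₂ = ⟦ y ⊳ φ ⟧ (stuffleW (a ∷ U) [])
    P₃ = ⟦ (a ⊞ y) ⊳ φ ⟧ (word U)
    Q₁ = ⟦ (a ⊳ φ) ⊲ x ⟧ (stuffleW u (y ∷ []))
    Q₂ = ⟦ (a ⊳ φ) ⊲ y ⟧ (word U)
    Q₃ = ⟦ (a ⊳ φ) ⊲ (x ⊞ y) ⟧ (word u)
  stuffle-snoc (a ∷ u) (b ∷ v) x y φ = begin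
    ⟦ φ ⟧ (stuffleW (a ∷ U) (b ∷ V))
      ≈⟨ stuffle-cons φ a U b V ⟩
    ⟦ a ⊳ φ ⟧ (stuffleW U (b ∷ V)) + (⟦ b ⊳ φ ⟧ (stuffleW (a ∷ U) V) + ⟦ (a ⊞ b) ⊳ φ ⟧ (stuffleW U V))
      ≈⟨ +-cong (stuffle-snoc u (b ∷ v) x y _) (+-cong (stuffle-snoc (a ∷ u) v x y _) (stuffle-snoc u v x y _)) ⟩
    (A₁ + (A₂ + A₃)) + ((B₁ + (B₂ + B₃)) + (C₁ + (C₂ + C₃)))
      ≈⟨ solve 9 (λ A₁ A₂ A₃ B₁ B₂ B₃ C₁ C₂ C₃ →
             (A₁ ⊕ (A₂ ⊕ A₃)) ⊕ ((B₁ ⊕ (B₂ ⊕ B₃)) ⊕ (C₁ ⊕ (C₂ ⊕ C₃))) ⊜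
             (A₁ ⊕ (B₁ ⊕ C₁)) ⊕ ((A₂ ⊕ (B₂ ⊕ C₂)) ⊕ (A₃ ⊕ (B₃ ⊕ C₃)))) refl
           A₁ A₂ A₃ B₁ B₂ B₃ C₁ C₂ C₃ ⟩
    (A₁ + (B₁ + C₁)) + ((A₂ + (B₂ + C₂)) + (A₃ + (B₃ + C₃)))
      ≈⟨ +-cong (stuffle-cons _ a u b V) (+-cong (stuffle-cons _ a U b v) (stuffle-cons _ a u b v)) ⟨
    ⟦ φ ⊲ x ⟧ (stuffleW (a ∷ u) (b ∷ V)) + (⟦ φ ⊲ y ⟧ (stuffleW (a ∷ U) (b ∷ v)) + ⟦ φ ⊲ (x ⊞ y) ⟧ (stuffleW (a ∷ u) (b ∷ v))) ∎
    where
    U = u ∷ʳ x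
    V = v ∷ʳ y
    A₁ = ⟦ (a ⊳ φ) ⊲ x ⟧ (stuffleW u (b ∷ V))
    A₂ = ⟦ (a ⊳ φ) ⊲ y ⟧ (stuffleW U (b ∷ v))
    A₃ = ⟦ (a ⊳ φ) ⊲ (x ⊞ y) ⟧ (stuffleW u (b ∷ v))
    B₁ = ⟦ (b ⊳ φ) ⊲ x ⟧ (stuffleW (a ∷ u) V)
    B₂ = ⟦ (b ⊳ φ) ⊲ y ⟧ (stuffleW (a ∷ U) v)
    B₃ = ⟦ (b ⊳ φ) ⊲ (x ⊞ y) ⟧ (stuffleW (a ∷ u) v)
    C₁ = ⟦ ((a ⊞ b) ⊳ φ) ⊲ x ⟧ (stuffleW u V)
    C₂ = ⟦ ((a ⊞ b) ⊳ φ) ⊲ y ⟧ (stuffleW U v)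
    C₃ = ⟦ ((a ⊞ b) ⊳ φ) ⊲ (x ⊞ y) ⟧ (stuffleW u v)

  stuffle-reverse : ∀ φ u v → ⟦ φ ⟧ (stuffleW u v) ≈ ⟦ φ ∘ reverse ⟧ (stuffleW (reverse u) (reverse v))
  stuffle-reverse φ [] v = trans (⟦⟧-word φ v)
    (sym (trans (⟦⟧-word (φ ∘ reverse) (reverse v)) (reflexive (≡.cong φ (ListP.reverse-involutive v)))))
  stuffle-reverse φ (a ∷ u) [] = trans (⟦⟧-word φ (a ∷ u))
    (sym (trans (stuffle-nilʳ (φ ∘ reverse) (reverse (a ∷ u)))
      (trans (⟦⟧-word (φ ∘ reverse) (reverse (a ∷ u))) (reflexive (≡.cong φ (ListP.reverse-involutive (a ∷ u)))))))
  stuffle-reverse φ (a ∷ u) (b ∷ v) = begin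
    ⟦ φ ⟧ (stuffleW (a ∷ u) (b ∷ v))
      ≈⟨ stuffle-cons φ a u b v ⟩
    ⟦ a ⊳ φ ⟧ (stuffleW u (b ∷ v)) + (⟦ b ⊳ φ ⟧ (stuffleW (a ∷ u) v) + ⟦ (a ⊞ b) ⊳ φ ⟧ (stuffleW u v))
      ≈⟨ +-cong (trans (stuffle-reverse _ u (b ∷ v)) (reflexive (≡.cong (λ z → ⟦ (a ⊳ φ) ∘ reverse ⟧ (stuffleW ru z)) rev-b∷v)))
         (+-cong (trans (stuffle-reverse _ (a ∷ u) v) (reflexive (≡.cong (λ z → ⟦ (b ⊳ φ) ∘ reverse ⟧ (stuffleW z rv)) rev-a∷u)))
                 (stuffle-reverse _ u v)) ⟩
    ⟦ (a ⊳ φ) ∘ reverse ⟧ (stuffleW ru (rv ∷ʳ b)) + (⟦ (b ⊳ φ) ∘ reverse ⟧ (stuffleW (ru ∷ʳ a) rv)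
      + ⟦ ((a ⊞ b) ⊳ φ) ∘ reverse ⟧ (stuffleW ru rv))
      ≈⟨ +-cong (reverse-snoc a (stuffleW ru (rv ∷ʳ b)))
           (+-cong (reverse-snoc b (stuffleW (ru ∷ʳ a) rv)) (reverse-snoc (a ⊞ b) (stuffleW ru rv))) ⟨
    ⟦ (φ ∘ reverse) ⊲ a ⟧ (stuffleW ru (rv ∷ʳ b)) + (⟦ (φ ∘ reverse) ⊲ b ⟧ (stuffleW (ru ∷ʳ a) rv)
      + ⟦ (φ ∘ reverse) ⊲ (a ⊞ b) ⟧ (stuffleW ru rv))
      ≈⟨ stuffle-snoc ru rv a b (φ ∘ reverse) ⟨
    ⟦ φ ∘ reverse ⟧ (stuffleW (ru ∷ʳ a) (rv ∷ʳ b))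
      ≈⟨ reflexive (≡.cong₂ (λ z z′ → ⟦ φ ∘ reverse ⟧ (stuffleW z z′)) rev-a∷u rev-b∷v) ⟨
    ⟦ φ ∘ reverse ⟧ (stuffleW (reverse (a ∷ u)) (reverse (b ∷ v))) ∎
    where
    ru = reverse u
    rv = reverse v
    rev-a∷u : reverse (a ∷ u) ≡ ru ∷ʳ a
    rev-a∷u = ListP.unfold-reverse a u
    rev-b∷v : reverse (b ∷ v) ≡ rv ∷ʳ b
    rev-b∷v = ListP.unfold-reverse b v
    reverse-snoc : ∀ x p → ⟦ (φ ∘ reverse) ⊲ x ⟧ p ≈ ⟦ (x ⊳ φ) ∘ reverse ⟧ p
    reverse-snoc x p = ⟦⟧-cong p (λ w → reflexive (≡.cong φ (ListP.reverse-++ w (x ∷ []))))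

-- Deconcatenation  Δ w = Σ_{w = p q} p ⊗ q  is a morphism for the stuffle
-- product.  Dually: the convolution φ ⊛ ψ of two maps, tested on u ∗ v, is
-- the sum over deconcatenations of u and v of products of stuffles.
module Deconcatenation {c ℓ} (R : QAlgebra c ℓ) where
  open QAlgebra R
  open LinearExtension R
  open StuffleIdentities R
  open import Relation.Binary.Reasoning.Setoid setoid
  open import Algebra.Solver.CommutativeMonoid +-commutativeMonoid using (solve; _⊜_; _⊕_)

  splitSum : Word → (Word → Word → Carrier) → Carrier
  splitSum w h = ∑ (map (λ pq → h (proj₁ pq) (proj₂ pq)) (splits R w))

  splitSum-nil : ∀ h → splitSum [] h ≈ h [] []
  splitSum-nil h = +-identityʳ _

  splitSum-cons : ∀ x w h → splitSum (x ∷ w) h ≈ h [] (x ∷ w) + splitSum w (λ p q → h (x ∷ p) q)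
  splitSum-cons x w h = +-congˡ (reflexive (≡.cong ∑ (≡.sym (ListP.map-∘ (splits R w)))))

  splitSum-cong : ∀ w {h k} → (∀ p q → h p q ≈ k p q) → splitSum w h ≈ splitSum w k
  splitSum-cong w e = ∑map-cong (splits R w) (λ pq → e (proj₁ pq) (proj₂ pq))

  splitSum-+ : ∀ w h k → splitSum w (λ p q → h p q + k p q) ≈ splitSum w h + splitSum w k
  splitSum-+ w h k = ∑map-+ _ _ (splits R w)

  splitSum-*ˡ : ∀ w a h → a * splitSum w h ≈ splitSum w (λ p q → a * h p q)
  splitSum-*ˡ w a h = ∑map-*ˡ a _ (splits R w)

  splitSum-*ʳ : ∀ w a h → splitSum w h * a ≈ splitSum w (λ p q → h p q * a)
  splitSum-*ʳ w a h = ∑map-*ʳ a _ (splits R w)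

  Σad-splitSum : ∀ n w (H : ℕ → ℕ → Word → Word → Carrier) →
    Σad n (λ i j → splitSum w (H i j)) ≈ splitSum w (λ p q → Σad n (λ i j → H i j p q))
  Σad-splitSum n w H = Σad-∑ n (λ i j pq → H i j (proj₁ pq) (proj₂ pq)) (splits R w)

  _⊛_ : (Word → Carrier) → (Word → Carrier) → Word → Carrier
  (φ ⊛ ψ) w = splitSum w (λ p q → φ p * ψ q)

  ⊛-cons : ∀ φ ψ c p → ⟦ c ⊳ (φ ⊛ ψ) ⟧ p ≈ φ [] * ⟦ c ⊳ ψ ⟧ p + ⟦ (c ⊳ φ) ⊛ ψ ⟧ p
  ⊛-cons φ ψ c p = trans (⟦⟧-cong p (λ w → splitSum-cons c w _))
    (trans (⟦⟧-+ _ _ p) (+-congʳ (⟦⟧-*ˡ (φ []) (c ⊳ ψ) p)))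

  splitStuffle : (Word → Carrier) → (Word → Carrier) → Word → Word → Carrier
  splitStuffle φ ψ a b =
    splitSum a (λ a₁ a₂ → splitSum b (λ b₁ b₂ → ⟦ φ ⟧ (stuffleW a₁ b₁) * ⟦ ψ ⟧ (stuffleW a₂ b₂)))

  -- both sides satisfy the same recursion on two non-empty words
  ⊛-stuffle-cons : ∀ φ ψ x a y b → ⟦ φ ⊛ ψ ⟧ (stuffleW (x ∷ a) (y ∷ b)) ≈
    φ [] * ⟦ ψ ⟧ (stuffleW (x ∷ a) (y ∷ b)) + (⟦ (x ⊳ φ) ⊛ ψ ⟧ (stuffleW a (y ∷ b))
      + (⟦ (y ⊳ φ) ⊛ ψ ⟧ (stuffleW (x ∷ a) b) + ⟦ ((x ⊞ y) ⊳ φ) ⊛ ψ ⟧ (stuffleW a b)))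
  ⊛-stuffle-cons φ ψ x a y b = begin
    ⟦ φ ⊛ ψ ⟧ (stuffleW (x ∷ a) (y ∷ b))
      ≈⟨ stuffle-cons (φ ⊛ ψ) x a y b ⟩
    ⟦ x ⊳ (φ ⊛ ψ) ⟧ (stuffleW a (y ∷ b)) + (⟦ y ⊳ (φ ⊛ ψ) ⟧ (stuffleW (x ∷ a) b) + ⟦ z ⊳ (φ ⊛ ψ) ⟧ (stuffleW a b))
      ≈⟨ +-cong (⊛-cons φ ψ x (stuffleW a (y ∷ b))) (+-cong (⊛-cons φ ψ y (stuffleW (x ∷ a) b)) (⊛-cons φ ψ z (stuffleW a b))) ⟩
    (φ [] * Lx + Ix) + ((φ [] * Ly + Iy) + (φ [] * Lz + Iz))
      ≈⟨ solve 6 (λ Lx Ix Ly Iy Lz Iz → (Lx ⊕ Ix) ⊕ ((Ly ⊕ Iy) ⊕ (Lz ⊕ Iz)) ⊜ (Lx ⊕ (Ly ⊕ Lz)) ⊕ (Ix ⊕ (Iy ⊕ Iz))) refl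
           (φ [] * Lx) Ix (φ [] * Ly) Iy (φ [] * Lz) Iz ⟩
    (φ [] * Lx + (φ [] * Ly + φ [] * Lz)) + (Ix + (Iy + Iz))
      ≈⟨ +-congʳ (trans (*-congˡ (stuffle-cons ψ x a y b)) (trans (distribˡ _ _ _) (+-congˡ (distribˡ _ _ _)))) ⟨
    φ [] * ⟦ ψ ⟧ (stuffleW (x ∷ a) (y ∷ b)) + (Ix + (Iy + Iz)) ∎
    where
    z  = x ⊞ y
    Lx = ⟦ x ⊳ ψ ⟧ (stuffleW a (y ∷ b))
    Ly = ⟦ y ⊳ ψ ⟧ (stuffleW (x ∷ a) b)
    Lz = ⟦ z ⊳ ψ ⟧ (stuffleW a b)
    Ix = ⟦ (x ⊳ φ) ⊛ ψ ⟧ (stuffleW a (y ∷ b))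
    Iy = ⟦ (y ⊳ φ) ⊛ ψ ⟧ (stuffleW (x ∷ a) b)
    Iz = ⟦ (z ⊳ φ) ⊛ ψ ⟧ (stuffleW a b)

  splitSum²-cons : ∀ x a y b (H : Word → Word → Word → Word → Carrier) →
    splitSum (x ∷ a) (λ a₁ a₂ → splitSum (y ∷ b) (H a₁ a₂)) ≈
    (H [] (x ∷ a) [] (y ∷ b) + splitSum b (λ b₁ b₂ → H [] (x ∷ a) (y ∷ b₁) b₂))
      + splitSum a (λ a₁ a₂ → H (x ∷ a₁) a₂ [] (y ∷ b) + splitSum b (λ b₁ b₂ → H (x ∷ a₁) a₂ (y ∷ b₁) b₂))
  splitSum²-cons x a y b H = trans (splitSum-cons x a _)
    (+-cong (splitSum-cons y b _) (splitSum-cong a (λ a₁ a₂ → splitSum-cons y b _)))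

  splitStuffle-cons : ∀ φ ψ x a y b → splitStuffle φ ψ (x ∷ a) (y ∷ b) ≈
    φ [] * ⟦ ψ ⟧ (stuffleW (x ∷ a) (y ∷ b)) + (splitStuffle (x ⊳ φ) ψ a (y ∷ b)
      + (splitStuffle (y ⊳ φ) ψ (x ∷ a) b + splitStuffle ((x ⊞ y) ⊳ φ) ψ a b))
  splitStuffle-cons φ ψ x a y b = begin
    splitStuffle φ ψ (x ∷ a) (y ∷ b)
      ≈⟨ splitSum²-cons x a y b T ⟩
    (T [] (x ∷ a) [] (y ∷ b) + splitSum b (λ b₁ b₂ → T [] (x ∷ a) (y ∷ b₁) b₂))
      + splitSum a (λ a₁ a₂ → T (x ∷ a₁) a₂ [] (y ∷ b) + splitSum b (λ b₁ b₂ → T (x ∷ a₁) a₂ (y ∷ b₁) b₂))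
      ≈⟨ +-cong (+-congʳ (*-congʳ (⟦⟧-word φ []))) (splitSum-cong a (λ a₁ a₂ → +-congˡ (split-merged a₁ a₂))) ⟩
    (φ [] * ⟦ ψ ⟧ (stuffleW (x ∷ a) (y ∷ b)) + E₁)
      + splitSum a (λ a₁ a₂ → T (x ∷ a₁) a₂ [] (y ∷ b) + (S₁ a₁ a₂ + (S₂ a₁ a₂ + S₃ a₁ a₂)))
      ≈⟨ +-congˡ (trans (splitSum-cong a (λ a₁ a₂ → sym (+-assoc _ _ _)))
                        (trans (splitSum-+ a _ _) (+-congˡ (splitSum-+ a S₂ S₃)))) ⟩
    (φ [] * ⟦ ψ ⟧ (stuffleW (x ∷ a) (y ∷ b)) + E₁)
      + (splitSum a (λ a₁ a₂ → T (x ∷ a₁) a₂ [] (y ∷ b) + S₁ a₁ a₂) + (splitSum a S₂ + splitSum a S₃))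
      ≈⟨ solve 5 (λ L E₁ A B C → (L ⊕ E₁) ⊕ (A ⊕ (B ⊕ C)) ⊜ L ⊕ (A ⊕ ((E₁ ⊕ B) ⊕ C))) refl _ E₁ _ _ _ ⟩
    φ [] * ⟦ ψ ⟧ (stuffleW (x ∷ a) (y ∷ b))
      + (splitSum a (λ a₁ a₂ → T (x ∷ a₁) a₂ [] (y ∷ b) + S₁ a₁ a₂) + ((E₁ + splitSum a S₂) + splitSum a S₃))
      ≈⟨ +-congˡ (+-cong (splitSum-cong a (λ a₁ a₂ →
           trans (+-congʳ (*-congʳ (sym (stuffle-nilʳ (x ⊳ φ) a₁)))) (sym (splitSum-cons y b _))))
         (+-congʳ (sym (splitSum-cons x a _)))) ⟩
    φ [] * ⟦ ψ ⟧ (stuffleW (x ∷ a) (y ∷ b)) + (splitStuffle (x ⊳ φ) ψ a (y ∷ b)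
      + (splitStuffle (y ⊳ φ) ψ (x ∷ a) b + splitStuffle (z ⊳ φ) ψ a b)) ∎
    where
    z = x ⊞ y
    T : Word → Word → Word → Word → Carrier
    T a₁ a₂ b₁ b₂ = ⟦ φ ⟧ (stuffleW a₁ b₁) * ⟦ ψ ⟧ (stuffleW a₂ b₂)
    E₁ = splitSum b (λ b₁ b₂ → T [] (x ∷ a) (y ∷ b₁) b₂)
    S₁ S₂ S₃ : Word → Word → Carrier
    S₁ a₁ a₂ = splitSum b (λ b₁ b₂ → ⟦ x ⊳ φ ⟧ (stuffleW a₁ (y ∷ b₁)) * ⟦ ψ ⟧ (stuffleW a₂ b₂))
    S₂ a₁ a₂ = splitSum b (λ b₁ b₂ → ⟦ y ⊳ φ ⟧ (stuffleW (x ∷ a₁) b₁) * ⟦ ψ ⟧ (stuffleW a₂ b₂))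
    S₃ a₁ a₂ = splitSum b (λ b₁ b₂ → ⟦ z ⊳ φ ⟧ (stuffleW a₁ b₁) * ⟦ ψ ⟧ (stuffleW a₂ b₂))
    split-merged : ∀ a₁ a₂ →
      splitSum b (λ b₁ b₂ → T (x ∷ a₁) a₂ (y ∷ b₁) b₂) ≈ S₁ a₁ a₂ + (S₂ a₁ a₂ + S₃ a₁ a₂)
    split-merged a₁ a₂ = trans (splitSum-cong b (λ b₁ b₂ →
        trans (*-congʳ (stuffle-cons φ x a₁ y b₁)) (trans (distribʳ _ _ _) (+-congˡ (distribʳ _ _ _)))))
      (trans (splitSum-+ b _ _) (+-congˡ (splitSum-+ b _ _)))

  ⊛-stuffle : ∀ φ ψ a b → ⟦ φ ⊛ ψ ⟧ (stuffleW a b) ≈ splitStuffle φ ψ a b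
  ⊛-stuffle φ ψ [] b = trans (⟦⟧-word (φ ⊛ ψ) b)
    (sym (trans (splitSum-nil (λ a₁ a₂ → splitSum b (λ b₁ b₂ → ⟦ φ ⟧ (stuffleW a₁ b₁) * ⟦ ψ ⟧ (stuffleW a₂ b₂))))
      (splitSum-cong b (λ p q → *-cong (⟦⟧-word φ p) (⟦⟧-word ψ q)))))
  ⊛-stuffle φ ψ (x ∷ a) [] = trans (⟦⟧-word (φ ⊛ ψ) (x ∷ a))
    (sym (splitSum-cong (x ∷ a) (λ p q → trans (splitSum-nil (λ b₁ b₂ → ⟦ φ ⟧ (stuffleW p b₁) * ⟦ ψ ⟧ (stuffleW q b₂)))
      (*-cong (trans (stuffle-nilʳ φ p) (⟦⟧-word φ p)) (trans (stuffle-nilʳ ψ q) (⟦⟧-word ψ q))))))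
  ⊛-stuffle φ ψ (x ∷ a) (y ∷ b) = begin
    ⟦ φ ⊛ ψ ⟧ (stuffleW (x ∷ a) (y ∷ b))
      ≈⟨ ⊛-stuffle-cons φ ψ x a y b ⟩
    φ [] * ⟦ ψ ⟧ (stuffleW (x ∷ a) (y ∷ b)) + (⟦ (x ⊳ φ) ⊛ ψ ⟧ (stuffleW a (y ∷ b))
      + (⟦ (y ⊳ φ) ⊛ ψ ⟧ (stuffleW (x ∷ a) b) + ⟦ ((x ⊞ y) ⊳ φ) ⊛ ψ ⟧ (stuffleW a b)))
      ≈⟨ +-congˡ (+-cong (⊛-stuffle _ ψ a (y ∷ b)) (+-cong (⊛-stuffle _ ψ (x ∷ a) b) (⊛-stuffle _ ψ a b))) ⟩
    φ [] * ⟦ ψ ⟧ (stuffleW (x ∷ a) (y ∷ b)) + (splitStuffle (x ⊳ φ) ψ a (y ∷ b)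
      + (splitStuffle (y ⊳ φ) ψ (x ∷ a) b + splitStuffle ((x ⊞ y) ⊳ φ) ψ a b))
      ≈⟨ splitStuffle-cons φ ψ x a y b ⟨
    splitStuffle φ ψ (x ∷ a) (y ∷ b) ∎

-- ı_{∗,T} is a morphism for the stuffle product.  Tested against φ, the
-- coefficient of T^n of φ ∘ ı is the pullback of φ; the morphism property
-- reads: the pullback of φ, evaluated on a ∗ b, is the coefficient of T^n
-- of φ (ı a ∗ ı b).  Both sides satisfy the stuffle recursion.
module IotaMorphism {c ℓ} (R : QAlgebra c ℓ) where
  open QAlgebra R
  open LinearExtension R
  open StuffleIdentities R
  open import Relation.Binary.Reasoning.Setoid setoid

  κ : Letter → ℕ → Carrier
  κ a k = ι (ıcoeff a k)

  pullback : (Word → Carrier) → ℕ → Word → Carrier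
  pullback φ n w = ⟦ φ ⟧ (ıT w n)

  ⟦⟧-letter· : ∀ φ q b p → ⟦ φ ⟧ (((q , b ∷ []) ∷ []) · p) ≈ ι q * ⟦ b ⊳ φ ⟧ p
  ⟦⟧-letter· φ q b p = begin
    ⟦ φ ⟧ (concatMap (λ u → (q ℚ.* proj₁ u , b ∷ proj₂ u) ∷ []) p ++ [])
      ≈⟨ trans (⟦⟧-++ φ (concatMap (λ u → (q ℚ.* proj₁ u , b ∷ proj₂ u) ∷ []) p) []) (+-identityʳ _) ⟩
    ⟦ φ ⟧ (concatMap (λ u → (q ℚ.* proj₁ u , b ∷ proj₂ u) ∷ []) p)
      ≈⟨ ⟦⟧-concatMap φ _ p ⟩
    ∑ (map (λ u → ι (q ℚ.* proj₁ u) * φ (b ∷ proj₂ u) + 0#) p)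
      ≈⟨ ∑map-cong p (λ u → trans (+-identityʳ _) (trans (*-congʳ (*-homo q (proj₁ u))) (*-assoc _ _ _))) ⟩
    ∑ (map (λ u → ι q * (ι (proj₁ u) * φ (b ∷ proj₂ u))) p)
      ≈⟨ ∑map-*ˡ (ι q) _ p ⟨
    ι q * ⟦ b ⊳ φ ⟧ p ∎
    where open RingMorphisms.IsRingHomomorphism ι-hom using (*-homo)

  pullback-cons : ∀ φ x w n → pullback φ n (x ∷ w) ≈ Σad n (λ i j → κ x i * pullback ((i ℕ.+ x) ⊳ φ) j w)
  pullback-cons φ x w n = trans (⟦⟧-concatMap φ (λ ij → ıy x (proj₁ ij) · ıT w (proj₂ ij)) (antidiag n))
    (trans (∑antidiag≈Σad n (λ i j → ⟦ φ ⟧ (ıy x i · ıT w j)))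
      (Σad-cong n (λ i j → ⟦⟧-letter· φ (ıcoeff x i) (i ℕ.+ x) (ıT w j))))

  pullback-⊳ : ∀ φ c p n → ⟦ c ⊳ pullback φ n ⟧ p ≈ Σad n (λ k r → κ c k * ⟦ pullback ((k ℕ.+ c) ⊳ φ) r ⟧ p)
  pullback-⊳ φ c p n = trans (⟦⟧-cong p (λ w → pullback-cons φ c w n))
    (trans (sym (Σad-⟦⟧ n _ p)) (Σad-cong n (λ k r → ⟦⟧-*ˡ (κ c k) _ p)))

  pullbackʳ : (Word → Carrier) → Word → ℕ → Word → Carrier
  pullbackʳ φ b j u = pullback (λ v → ⟦ φ ⟧ (stuffleW u v)) j b

  -- the coefficient of T^n in φ (ı a ∗ ı b)
  ıPair : (Word → Carrier) → ℕ → Word → Word → Carrier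
  ıPair φ n a b = Σad n (λ i j → pullback (pullbackʳ φ b j) i a)

  pullback-Σad : ∀ α (β : ℕ → Carrier) (G : ℕ → ℕ → Word → Carrier) j m w →
    α * pullback (λ u → Σad j (λ l m′ → β l * G l m′ u)) m w ≈ Σad j (λ l m′ → (α * β l) * pullback (G l m′) m w)
  pullback-Σad α β G j m w = begin
    α * ⟦ (λ u → Σad j (λ l m′ → β l * G l m′ u)) ⟧ (ıT w m)
      ≈⟨ *-congˡ (Σad-⟦⟧ j _ (ıT w m)) ⟨
    α * Σad j (λ l m′ → ⟦ (λ u → β l * G l m′ u) ⟧ (ıT w m))
      ≈⟨ Σad-*ˡ j α _ ⟨
    Σad j (λ l m′ → α * ⟦ (λ u → β l * G l m′ u) ⟧ (ıT w m))
      ≈⟨ Σad-cong j (λ l m′ → trans (*-congˡ (⟦⟧-*ˡ (β l) _ (ıT w m))) (sym (*-assoc _ _ _))) ⟩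
    Σad j (λ l m′ → (α * β l) * pullback (G l m′) m w) ∎

  pullbackʳ-cons : ∀ φ y b X u j → pullbackʳ φ (y ∷ b) j (X ∷ u) ≈
    pullbackʳ (X ⊳ φ) (y ∷ b) j u + (Σad j (λ l m′ → κ y l * pullbackʳ ((l ℕ.+ y) ⊳ φ) b m′ (X ∷ u))
      + Σad j (λ l m′ → κ y l * pullbackʳ ((X ⊞ (l ℕ.+ y)) ⊳ φ) b m′ u))
  pullbackʳ-cons φ y b X u j = begin
    pullbackʳ φ (y ∷ b) j (X ∷ u)
      ≈⟨ pullback-cons (λ v → ⟦ φ ⟧ (stuffleW (X ∷ u) v)) y b j ⟩
    Σad j (λ l m′ → κ y l * ⟦ (λ v → ⟦ φ ⟧ (stuffleW (X ∷ u) ((l ℕ.+ y) ∷ v))) ⟧ (ıT b m′))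
      ≈⟨ Σad-cong j (λ l m′ → *-congˡ (trans (⟦⟧-cong (ıT b m′) (λ v → stuffle-cons φ X u (l ℕ.+ y) v))
           (⟦⟧-+₃ _ _ _ (ıT b m′)))) ⟩
    Σad j (λ l m′ → κ y l * (pullback ((l ℕ.+ y) ⊳ (λ v → ⟦ X ⊳ φ ⟧ (stuffleW u v))) m′ b
      + (pullbackʳ ((l ℕ.+ y) ⊳ φ) b m′ (X ∷ u) + pullbackʳ ((X ⊞ (l ℕ.+ y)) ⊳ φ) b m′ u)))
      ≈⟨ trans (Σad-cong j (λ l m′ → distribˡ₃ _ _ _ _)) (Σad-+₃ j _ _ _) ⟩
    Σad j (λ l m′ → κ y l * pullback ((l ℕ.+ y) ⊳ (λ v → ⟦ X ⊳ φ ⟧ (stuffleW u v))) m′ b)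
      + (Σad j (λ l m′ → κ y l * pullbackʳ ((l ℕ.+ y) ⊳ φ) b m′ (X ∷ u))
      + Σad j (λ l m′ → κ y l * pullbackʳ ((X ⊞ (l ℕ.+ y)) ⊳ φ) b m′ u))
      ≈⟨ +-congʳ (pullback-cons (λ v → ⟦ X ⊳ φ ⟧ (stuffleW u v)) y b j) ⟨
    pullbackʳ (X ⊳ φ) (y ∷ b) j u + (Σad j (λ l m′ → κ y l * pullbackʳ ((l ℕ.+ y) ⊳ φ) b m′ (X ∷ u))
      + Σad j (λ l m′ → κ y l * pullbackʳ ((X ⊞ (l ℕ.+ y)) ⊳ φ) b m′ u)) ∎

  -- ıPair of two non-empty words, expanded into three sums which are then
  -- identified with the three terms of the stuffle recursion
  module PairRecursion (φ : Word → Carrier) (x : Letter) (a : Word) (y : Letter) (b : Word) (n : ℕ) where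
    z = x ⊞ y

    Q₂ Q₃ : ℕ → ℕ → Word → Carrier
    Q₂ k j u = Σad j (λ l m′ → κ y l * pullbackʳ ((l ℕ.+ y) ⊳ φ) b m′ ((k ℕ.+ x) ∷ u))
    Q₃ k j u = Σad j (λ l m′ → κ y l * pullbackʳ (((k ℕ.+ x) ⊞ (l ℕ.+ y)) ⊳ φ) b m′ u)

    P₁ P₂ P₃ : Carrier
    P₁ = Σad n (λ i j → Σad i (λ k m → κ x k * pullback (pullbackʳ ((k ℕ.+ x) ⊳ φ) (y ∷ b) j) m a))
    P₂ = Σad n (λ i j → Σad i (λ k m → κ x k * pullback (Q₂ k j) m a))
    P₃ = Σad n (λ i j → Σad i (λ k m → κ x k * pullback (Q₃ k j) m a))

    expand : ıPair φ n (x ∷ a) (y ∷ b) ≈ P₁ + (P₂ + P₃)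
    expand = trans (Σad-cong n (λ i j → trans (pullback-cons (pullbackʳ φ (y ∷ b) j) x a i)
        (trans (Σad-cong i (λ k m → *-congˡ (trans (⟦⟧-cong (ıT a m) (λ u → pullbackʳ-cons φ y b (k ℕ.+ x) u j))
                                                    (⟦⟧-+₃ _ _ _ (ıT a m)))))
        (trans (Σad-cong i (λ k m → distribˡ₃ _ _ _ _)) (Σad-+₃ i _ _ _)))))
      (Σad-+₃ n _ _ _)

    part₁ : P₁ ≈ Σad n (λ k r → κ x k * ıPair ((k ℕ.+ x) ⊳ φ) r a (y ∷ b))
    part₁ = trans (Σad-assoc n (λ k m j → κ x k * pullback (pullbackʳ ((k ℕ.+ x) ⊳ φ) (y ∷ b) j) m a))
                  (Σad-cong n (λ k r → Σad-*ˡ r (κ x k) _))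

    part₂ : P₂ ≈ Σad n (λ l r → κ y l * ıPair ((l ℕ.+ y) ⊳ φ) r (x ∷ a) b)
    part₂ = begin
      P₂
        ≈⟨ Σad-cong n (λ i j → trans (Σad-cong i (λ k m → pullback-Σad (κ x k) (κ y) _ j m a)) (Σad-comm i j _)) ⟩
      Σad n (λ i j → Σad j (λ l m′ → Σad i (λ k m → (κ x k * κ y l) * pullback ((k ℕ.+ x) ⊳ G l m′) m a)))
        ≈⟨ Σad-cong n (λ i j → Σad-cong j (λ l m′ → collect-x l m′ i)) ⟩
      Σad n (λ i j → Σad j (λ l m′ → κ y l * pullback (G l m′) i (x ∷ a)))
        ≈⟨ trans (Σad-swap n _) (Σad-assoc n (λ l m′ i → κ y l * pullback (G l m′) i (x ∷ a))) ⟩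
      Σad n (λ l r → Σad r (λ m′ i → κ y l * pullback (G l m′) i (x ∷ a)))
        ≈⟨ Σad-cong n (λ l r → trans (Σad-swap r _) (Σad-*ˡ r (κ y l) _)) ⟩
      Σad n (λ l r → κ y l * ıPair ((l ℕ.+ y) ⊳ φ) r (x ∷ a) b) ∎
      where
      G : ℕ → ℕ → Word → Carrier
      G l m′ = pullbackʳ ((l ℕ.+ y) ⊳ φ) b m′
      -- the scalars commute, and the sum over (k , m) rebuilds ı(y_x a)
      collect-x : ∀ l m′ i →
        Σad i (λ k m → (κ x k * κ y l) * pullback ((k ℕ.+ x) ⊳ G l m′) m a) ≈ κ y l * pullback (G l m′) i (x ∷ a)
      collect-x l m′ i = begin
        Σad i (λ k m → (κ x k * κ y l) * pullback ((k ℕ.+ x) ⊳ G l m′) m a)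
          ≈⟨ Σad-cong i (λ k m → trans (*-congʳ (ι-central _ _)) (*-assoc _ _ _)) ⟩
        Σad i (λ k m → κ y l * (κ x k * pullback ((k ℕ.+ x) ⊳ G l m′) m a))
          ≈⟨ Σad-*ˡ i (κ y l) _ ⟩
        κ y l * Σad i (λ k m → κ x k * pullback ((k ℕ.+ x) ⊳ G l m′) m a)
          ≈⟨ *-congˡ (pullback-cons (G l m′) x a i) ⟨
        κ y l * pullback (G l m′) i (x ∷ a) ∎

    part₃ : P₃ ≈ Σad n (λ p r → κ z p * ıPair ((p ℕ.+ z) ⊳ φ) r a b)
    part₃ = begin
      P₃
        ≈⟨ Σad-cong n (λ i j → Σad-cong i (λ k m → trans (pullback-Σad (κ x k) (κ y) _ j m a)
             (Σad-cong j (λ l m′ → *-congˡ (reflexive (≡.cong (λ q → pullback (pullbackʳ (q ⊳ φ) b m′) m a)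
                                                          (⊞-shift k x l y))))))) ⟩
      Σad n (λ i j → Σad i (λ k m → Σad j (λ l m′ → H (k ℕ.+ l) k l m m′)))
        ≈⟨ Σad-middle n (λ k m l m′ → H (k ℕ.+ l) k l m m′) ⟩
      Σad n (λ p r → Σad p (λ k l → Σad r (λ m m′ → H (k ℕ.+ l) k l m m′)))
        ≈⟨ Σad-cong n (λ p r → Σad-shift p (λ q k l → Σad r (λ m m′ → H q k l m m′))) ⟩
      Σad n (λ p r → Σad p (λ k l → Σad r (λ m m′ → H p k l m m′)))
        ≈⟨ Σad-cong n (λ p r → trans (Σad-cong p (λ k l → Σad-*ˡ r _ _))
             (trans (Σad-*ʳ p _ _) (*-congʳ (ι-convolution x y p)))) ⟩
      Σad n (λ p r → κ z p * ıPair ((p ℕ.+ z) ⊳ φ) r a b) ∎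
      where
      H : ℕ → ℕ → ℕ → ℕ → ℕ → Carrier
      H p k l m m′ = (κ x k * κ y l) * pullback (pullbackʳ ((p ℕ.+ z) ⊳ φ) b m′) m a

  ıPair-cons : ∀ φ x a y b n → ıPair φ n (x ∷ a) (y ∷ b) ≈
    Σad n (λ k r → κ x k * ıPair ((k ℕ.+ x) ⊳ φ) r a (y ∷ b))
      + (Σad n (λ l r → κ y l * ıPair ((l ℕ.+ y) ⊳ φ) r (x ∷ a) b)
      + Σad n (λ p r → κ (x ⊞ y) p * ıPair ((p ℕ.+ (x ⊞ y)) ⊳ φ) r a b))
  ıPair-cons φ x a y b n = trans expand (+-cong part₁ (+-cong part₂ part₃))
    where open PairRecursion φ x a y b n

  ı-stuffle : ∀ φ n a b → ⟦ pullback φ n ⟧ (stuffleW a b) ≈ ıPair φ n a b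
  ı-stuffle φ n [] b = trans (⟦⟧-word (pullback φ n) b) (sym (trans (Σad-left n _ (λ i j → refl))
    (trans (⟦⟧-word (pullbackʳ φ b n) []) (⟦⟧-cong (ıT b n) (⟦⟧-word φ)))))
  ı-stuffle φ n (x ∷ a) [] = trans (⟦⟧-word (pullback φ n) (x ∷ a))
    (sym (trans (Σad-right n _ (λ i j → ⟦⟧-zero _ (ıT (x ∷ a) i) (λ u → refl)))
      (⟦⟧-cong (ıT (x ∷ a) n) (λ u → trans (⟦⟧-word (λ v → ⟦ φ ⟧ (stuffleW u v)) [])
        (trans (stuffle-nilʳ φ u) (⟦⟧-word φ u))))))
  ı-stuffle φ n (x ∷ a) (y ∷ b) = begin
    ⟦ pullback φ n ⟧ (stuffleW (x ∷ a) (y ∷ b))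
      ≈⟨ stuffle-cons (pullback φ n) x a y b ⟩
    ⟦ x ⊳ pullback φ n ⟧ (stuffleW a (y ∷ b))
      + (⟦ y ⊳ pullback φ n ⟧ (stuffleW (x ∷ a) b) + ⟦ z ⊳ pullback φ n ⟧ (stuffleW a b))
      ≈⟨ +-cong (pullback-⊳ φ x (stuffleW a (y ∷ b)) n)
           (+-cong (pullback-⊳ φ y (stuffleW (x ∷ a) b) n) (pullback-⊳ φ z (stuffleW a b) n)) ⟩
    Σad n (λ k r → κ x k * ⟦ pullback ((k ℕ.+ x) ⊳ φ) r ⟧ (stuffleW a (y ∷ b)))
      + (Σad n (λ l r → κ y l * ⟦ pullback ((l ℕ.+ y) ⊳ φ) r ⟧ (stuffleW (x ∷ a) b))
      + Σad n (λ p r → κ z p * ⟦ pullback ((p ℕ.+ z) ⊳ φ) r ⟧ (stuffleW a b)))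
      ≈⟨ +-cong (Σad-cong n (λ k r → *-congˡ (ı-stuffle _ r a (y ∷ b))))
           (+-cong (Σad-cong n (λ l r → *-congˡ (ı-stuffle _ r (x ∷ a) b)))
                   (Σad-cong n (λ p r → *-congˡ (ı-stuffle _ r a b)))) ⟩
    Σad n (λ k r → κ x k * ıPair ((k ℕ.+ x) ⊳ φ) r a (y ∷ b))
      + (Σad n (λ l r → κ y l * ıPair ((l ℕ.+ y) ⊳ φ) r (x ∷ a) b)
      + Σad n (λ p r → κ z p * ıPair ((p ℕ.+ z) ⊳ φ) r a b))
      ≈⟨ ıPair-cons φ x a y b n ⟨
    ıPair φ n (x ∷ a) (y ∷ b) ∎
    where z = x ⊞ y

module Characters {c ℓ} (R : QAlgebra c ℓ) (f : Word → QAlgebra.Carrier R)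
                  (f-character : IsStuffleCharacter R (lin R f)) where
  open QAlgebra R
  open RingMorphisms.IsRingHomomorphism ι-hom using (*-homo)
  open LinearExtension R
  open StuffleIdentities R
  open Deconcatenation R
  open IotaMorphism R
  open import Relation.Binary.Reasoning.Setoid setoid

  f-stuffle : ∀ a b → ⟦ f ⟧ (stuffleW a b) ≈ f a * f b
  f-stuffle a b = begin
    ⟦ f ⟧ (stuffleW a b)
      ≈⟨ trans (⟦⟧-word (λ a′ → ⟦ (λ b′ → ⟦ f ⟧ (stuffleW a′ b′)) ⟧ (word b)) a) (⟦⟧-word (λ b′ → ⟦ f ⟧ (stuffleW a b′)) b) ⟨
    ⟦ (λ a′ → ⟦ (λ b′ → ⟦ f ⟧ (stuffleW a′ b′)) ⟧ (word b)) ⟧ (word a)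
      ≈⟨ ⟦⟧-∗ f (word a) (word b) ⟨
    ⟦ f ⟧ (word a ∗ word b)
      ≈⟨ f-character (word a) (word b) ⟩
    ⟦ f ⟧ (word a) * ⟦ f ⟧ (word b)
      ≈⟨ *-cong (⟦⟧-word f a) (⟦⟧-word f b) ⟩
    f a * f b ∎

  -- the stuffle is commutative, so the values of f commute (R need not be)
  f-commute : ∀ a p → f a * ⟦ f ⟧ p ≈ ⟦ f ⟧ p * f a
  f-commute a p = trans (sym (⟦⟧-*ˡ (f a) f p)) (trans (⟦⟧-cong p commute) (⟦⟧-*ʳ (f a) f p))
    where
    commute : ∀ b → f a * f b ≈ f b * f a
    commute b = trans (sym (f-stuffle a b)) (trans (stuffle-comm f a b) (f-stuffle b a))

  twisted : Word → Carrier
  twisted w = ι (sgn (weight w)) * f (reverse w)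

  ⟦⟧-inv : ∀ p → ⟦ f ⟧ (inv p) ≈ ⟦ twisted ⟧ p
  ⟦⟧-inv []      = refl
  ⟦⟧-inv (t ∷ p) = +-cong (trans (*-congʳ (trans (*-homo _ _) (ι-central _ _))) (*-assoc _ _ _)) (⟦⟧-inv p)

  -- inv is a stuffle morphism: sign by homogeneity, reversal by stuffle-reverse
  twisted-stuffle : ∀ u v → ⟦ twisted ⟧ (stuffleW u v) ≈ twisted u * twisted v
  twisted-stuffle u v = begin
    ⟦ twisted ⟧ (stuffleW u v)
      ≈⟨ stuffle-weight (λ m w → ι (sgn m) * f (reverse w)) u v ⟩
    ⟦ (λ w → ι (sgn (weight u ℕ.+ weight v)) * f (reverse w)) ⟧ (stuffleW u v)
      ≈⟨ ⟦⟧-*ˡ _ (f ∘ reverse) (stuffleW u v) ⟩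
    ι (sgn (weight u ℕ.+ weight v)) * ⟦ f ∘ reverse ⟧ (stuffleW u v)
      ≈⟨ *-cong (trans (reflexive (≡.cong ι (sgn-+ (weight u) (weight v)))) (*-homo _ _)) reversed ⟩
    (ι (sgn (weight u)) * ι (sgn (weight v))) * (f (reverse u) * f (reverse v))
      ≈⟨ interchange _ _ _ _ ⟩
    twisted u * twisted v ∎
    where
    reversed : ⟦ f ∘ reverse ⟧ (stuffleW u v) ≈ f (reverse u) * f (reverse v)
    reversed = trans (stuffle-reverse (f ∘ reverse) u v)
      (trans (⟦⟧-cong (stuffleW (reverse u) (reverse v)) (λ w → reflexive (≡.cong f (ListP.reverse-involutive w))))
             (f-stuffle (reverse u) (reverse v)))
    interchange : ∀ q q′ A B → (ι q * ι q′) * (A * B) ≈ (ι q * A) * (ι q′ * B)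
    interchange q q′ A B = trans (*-assoc _ _ _) (trans (*-congˡ (ι-swap q′ A B)) (sym (*-assoc _ _ _)))

  fρ : ℕ → Word → Carrier
  fρ n w = ⟦ f ⟧ (ρT w n)

  -- f ∘ ρ_T = (f ∘ inv) ∘ ı_{∗,T} is a character: ı and inv are stuffle morphisms
  fρ-stuffle : ∀ a b n → ⟦ fρ n ⟧ (stuffleW a b) ≈ Σad n (λ i j → fρ i a * fρ j b)
  fρ-stuffle a b n = begin
    ⟦ fρ n ⟧ (stuffleW a b)
      ≈⟨ ⟦⟧-cong (stuffleW a b) (λ w → ⟦⟧-inv (ıT w n)) ⟩
    ⟦ pullback twisted n ⟧ (stuffleW a b)
      ≈⟨ ı-stuffle twisted n a b ⟩
    Σad n (λ i j → pullback (pullbackʳ twisted b j) i a)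
      ≈⟨ Σad-cong n (λ i j → ⟦⟧-cong (ıT a i) (λ u → trans (⟦⟧-cong (ıT b j) (twisted-stuffle u))
                                                          (⟦⟧-*ˡ (twisted u) twisted (ıT b j)))) ⟩
    Σad n (λ i j → ⟦ (λ u → twisted u * pullback twisted j b) ⟧ (ıT a i))
      ≈⟨ Σad-cong n (λ i j → trans (⟦⟧-*ʳ _ twisted (ıT a i)) (sym (*-cong (⟦⟧-inv (ıT a i)) (⟦⟧-inv (ıT b j))))) ⟩
    Σad n (λ i j → fρ i a * fρ j b) ∎

  -- g on words, coefficient of T^n, is the convolution (f ∘ ρ_T) ⊛ f
  gW-stuffle : ∀ a b n → ⟦ (λ w → gW R f w n) ⟧ (stuffleW a b) ≈ Σad n (λ i j → gW R f a i * gW R f b j)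
  gW-stuffle a b n = begin
    ⟦ fρ n ⊛ f ⟧ (stuffleW a b)
      ≈⟨ ⊛-stuffle (fρ n) f a b ⟩
    splitStuffle (fρ n) f a b
      ≈⟨ splitSum-cong a (λ a₁ a₂ → splitSum-cong b (λ b₁ b₂ → trans (*-cong (fρ-stuffle a₁ b₁ n) (f-stuffle a₂ b₂))
           (trans (sym (Σad-*ʳ n _ _)) (Σad-cong n (λ i j → regroup (fρ i a₁) (ρT b₁ j) a₂ (f b₂)))))) ⟩
    splitSum a (λ a₁ a₂ → splitSum b (λ b₁ b₂ → Σad n (λ i j → (fρ i a₁ * f a₂) * (fρ j b₁ * f b₂))))
      ≈⟨ trans (Σad-splitSum n a _) (splitSum-cong a (λ a₁ a₂ → Σad-splitSum n b _)) ⟨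
    Σad n (λ i j → splitSum a (λ a₁ a₂ → splitSum b (λ b₁ b₂ → (fρ i a₁ * f a₂) * (fρ j b₁ * f b₂))))
      ≈⟨ Σad-cong n (λ i j → trans (splitSum-*ʳ a _ _) (splitSum-cong a (λ a₁ a₂ → splitSum-*ˡ b _ _))) ⟨
    Σad n (λ i j → gW R f a i * gW R f b j) ∎
    where
    -- fρ j b₁ = ⟦ f ⟧ (ρT b₁ j) commutes with f a₂
    regroup : ∀ A p a₂ D → (A * ⟦ f ⟧ p) * (f a₂ * D) ≈ (A * f a₂) * (⟦ f ⟧ p * D)
    regroup A p a₂ D = trans (*-assoc _ _ _) (trans (*-congˡ (trans (sym (*-assoc _ _ _))
      (trans (*-congʳ (sym (f-commute a₂ p))) (*-assoc _ _ _)))) (sym (*-assoc _ _ _)))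

theorem1 : ∀ {c ℓ : Level} (R : QAlgebra c ℓ) (f : Word → QAlgebra.Carrier R) →
    IsStuffleCharacter R (lin R f) →
    IsStuffleCharacterT R (g R f)
theorem1 R f f-character u v n = begin
  ⟦ (λ w → gW R f w n) ⟧ (u ∗ v)
    ≈⟨ ⟦⟧-∗ _ u v ⟩
  ⟦ (λ a → ⟦ (λ b → ⟦ (λ w → gW R f w n) ⟧ (stuffleW a b)) ⟧ v) ⟧ u
    ≈⟨ ⟦⟧-cong u (λ a → ⟦⟧-cong v (λ b → gW-stuffle a b n)) ⟩
  ⟦ (λ a → ⟦ (λ b → Σad n (λ i j → gW R f a i * gW R f b j)) ⟧ v) ⟧ u
    ≈⟨ trans (Σad-⟦⟧ n _ u) (⟦⟧-cong u (λ a → Σad-⟦⟧ n _ v)) ⟨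
  Σad n (λ i j → ⟦ (λ a → ⟦ (λ b → gW R f a i * gW R f b j) ⟧ v) ⟧ u)
    ≈⟨ Σad-cong n (λ i j → ⟦⟧-product (λ a → gW R f a i) (λ b → gW R f b j) u v) ⟨
  Σad n (λ i j → g R f u i * g R f v j)
    ≈⟨ ∑antidiag≈Σad n (λ i j → g R f u i * g R f v j) ⟨
  _⊗_ R (g R f u) (g R f v) n ∎
  where
  open QAlgebra R
  open LinearExtension R
  open Characters R f f-character
  open import Relation.Binary.Reasoning.Setoid setoid
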